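{- For every set $S$, the free (unitless) linearly distributive category $F^{\mathrm{LD}}_S$ on $S$ is thin; equivalently, every formal diagram in a unitless linearly distributive category commutes. The same holds for unitless lax linearly distributive categories: the free unitless lax linearly distributive category on any set $S$ is thin, equivalently every formal diagram in a unitless lax linearly distributive category commutes.
   Context: A (unitless) lax linearly distributive (LD) category is a category $\mathcal C$ with two bifunctors $\otimes,\odot:\mathcal C\times\mathcal C\to\mathcal C$ (no unit objects are assumed; $\odot$ plays the role of the "par" product) and natural transformations, not necessarily invertible, $\alpha_{A,B,C}:A\otimes(B\otimes C)\to(A\otimes B)\otimes C$, $\bar\alpha_{A,B,C}:A\odot(B\odot C)\to(A\odot B)\odot C$ (associators), $\delta^l_{A,B,C}:A\otimes(B\odot C)\to(A\otimes B)\odot C$, $\delta^r_{A,B,C}:(A\odot B)\otimes C\to A\odot(B\otimes C)$ (distributors), such that for all objects $A,B,C,D$ (writing an object for its identity morphism): (P1) $\alpha_{A\otimes B,C,D}\circ\alpha_{A,B,C\otimes D}=(\alpha_{A,B,C}\otimes D)\circ\alpha_{A,B\otimes C,D}\circ(A\otimes\alpha_{B,C,D})$; (P2) $\delta^l_{A\otimes B,C,D}\circ\alpha_{A,B,C\odot D}=(\alpha_{A,B,C}\odot D)\circ\delta^l_{A,B\otimes C,D}\circ(A\otimes\delta^l_{B,C,D})$; (P3) $\delta^l_{A,B,C\otimes D}\circ(A\otimes\delta^r_{B,C,D})=\delta^r_{A\otimes B,C,D}\circ(\delta^l_{A,B,C}\otimes D)\circ\alpha_{A,B\odot C,D}$;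 (P4) $\bar\alpha_{A\otimes B,C,D}\circ\delta^l_{A,B,C\odot D}=(\delta^l_{A,B,C}\odot D)\circ\delta^l_{A,B\odot C,D}\circ(A\otimes\bar\alpha_{B,C,D})$; (P5) $(A\odot\alpha_{B,C,D})\circ\delta^r_{A,B,C\otimes D}=\delta^r_{A,B\otimes C,D}\circ(\delta^r_{A,B,C}\otimes D)\circ\alpha_{A\odot B,C,D}$; (P6) $(\delta^r_{A,B,C}\odot D)\circ\delta^l_{A\odot B,C,D}=\bar\alpha_{A,B\otimes C,D}\circ(A\odot\delta^l_{B,C,D})\circ\delta^r_{A,B,C\odot D}$; (P7) $\delta^r_{A\odot B,C,D}\circ(\bar\alpha_{A,B,C}\otimes D)=\bar\alpha_{A,B,C\otimes D}\circ(A\odot\delta^r_{B,C,D})\circ\delta^r_{A,B\odot C,D}$; (P8) $\bar\alpha_{A\odot B,C,D}\circ\bar\alpha_{A,B,C\odot D}=(\bar\alpha_{A,B,C}\odot D)\circ\bar\alpha_{A,B\odot C,D}\circ(A\odot\bar\alpha_{B,C,D})$. An LD category is a lax LD category in which $\alpha$ and $\bar\alpha$ are invertible. A strict structure-preserving functor between LD categories is a functor strictly preserving $\otimes,\odot$ and the components of $\alpha,\bar\alpha,\delta^l,\delta^r$. The free LD category $F^{\mathrm{LD}}_S$ on a set $S$: its objects are the formal expressions generated from $S$ by the binary operations $\otimes$ and $\odot$; its morphisms are generated by identities and components of $\alpha,\alpha^{ -1},\bar\alpha,\bar\alpha^{ -1},\delta^l,\delta^r$ under composition, $\otimes$ and $\odot$,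 modulo exactly the relations making it a category, $\otimes,\odot$ bifunctors, $\alpha,\bar\alpha,\delta^l,\delta^r$ natural, $\alpha^{\pm1}$ and $\bar\alpha^{\pm1}$ mutually inverse, and (P1)–(P8) hold. It has the universal property: every function from $S$ to the objects of an LD category $\mathcal C$ extends uniquely to a strict structure-preserving functor $F^{\mathrm{LD}}_S\to\mathcal C$. The free lax LD category is defined analogously, omitting $\alpha^{ -1},\bar\alpha^{ -1}$. A category is thin if between any two objects there is at most one morphism. For an LD category $\mathcal C$, let $\varepsilon_{\mathcal C}:F^{\mathrm{LD}}_{\mathrm{Ob}(\mathcal C)}\to\mathcal C$ be the strict functor extending the identity on objects; a diagram $D:J\to\mathcal C$ is formal if $D=\varepsilon_{\mathcal C}\circ D^\sharp$ for some diagram $D^\sharp:J\to F^{\mathrm{LD}}_{\mathrm{Ob}(\mathcal C)}$ (analogously for lax LD categories). -}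

module Defs where

open import Data.Product using (_×_)

data Ob (S : Set) : Set where
  var : S → Ob S
  _⊗_ : Ob S → Ob S → Ob S
  _⊙_ : Ob S → Ob S → Ob S

infixr 6 _⊗_ _⊙_

-- Which free structure: 'lax' (associators not invertible, no α⁻¹, ᾱ⁻¹)
-- or 'strong' (an LD category: α⁻¹ and ᾱ⁻¹ are available).
data Kind : Set where
  lax strong : Kind

data Hom {S : Set} : Kind → Ob S → Ob S → Set where
  id    : ∀ {k A} → Hom k A A
  _∘_   : ∀ {k A B C} → Hom k B C → Hom k A B → Hom k A C
  _⊗₁_  : ∀ {k A B A' B'} → Hom k A A' → Hom k B B' → Hom k (A ⊗ B) (A' ⊗ B')
  _⊙₁_  : ∀ {k A B A' B'} → Hom k A A' → Hom k B B' → Hom k (A ⊙ B) (A' ⊙ B')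
  α     : ∀ {k A B C} → Hom k (A ⊗ (B ⊗ C)) ((A ⊗ B) ⊗ C)
  α⁻¹   : ∀ {A B C} → Hom strong ((A ⊗ B) ⊗ C) (A ⊗ (B ⊗ C))
  ᾱ     : ∀ {k A B C} → Hom k (A ⊙ (B ⊙ C)) ((A ⊙ B) ⊙ C)
  ᾱ⁻¹   : ∀ {A B C} → Hom strong ((A ⊙ B) ⊙ C) (A ⊙ (B ⊙ C))
  δˡ    : ∀ {k A B C} → Hom k (A ⊗ (B ⊙ C)) ((A ⊗ B) ⊙ C)
  δʳ    : ∀ {k A B C} → Hom k ((A ⊙ B) ⊗ C) (A ⊙ (B ⊗ C))

infixr 9 _∘_
infixr 7 _⊗₁_ _⊙₁_

data _≈_ {S : Set} : ∀ {k} {A B : Ob S} → Hom k A B → Hom k A B → Set where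
  ≈-refl  : ∀ {k A B} {f : Hom k A B} → f ≈ f
  ≈-sym   : ∀ {k A B} {f g : Hom k A B} → f ≈ g → g ≈ f
  ≈-trans : ∀ {k A B} {f g h : Hom k A B} → f ≈ g → g ≈ h → f ≈ h
  ∘-cong  : ∀ {k A B C} {f f' : Hom k B C} {g g' : Hom k A B} →
            f ≈ f' → g ≈ g' → (f ∘ g) ≈ (f' ∘ g')
  ⊗-cong  : ∀ {k A B A' B'} {f f' : Hom k A A'} {g g' : Hom k B B'} →
            f ≈ f' → g ≈ g' → (f ⊗₁ g) ≈ (f' ⊗₁ g')
  ⊙-cong  : ∀ {k A B A' B'} {f f' : Hom k A A'} {g g' : Hom k B B'} →
            f ≈ f' → g ≈ g' → (f ⊙₁ g) ≈ (f' ⊙₁ g')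
  idˡ     : ∀ {k A B} {f : Hom k A B} → (id ∘ f) ≈ f
  idʳ     : ∀ {k A B} {f : Hom k A B} → (f ∘ id) ≈ f
  assoc   : ∀ {k A B C D} {f : Hom k C D} {g : Hom k B C} {h : Hom k A B} →
            ((f ∘ g) ∘ h) ≈ (f ∘ (g ∘ h))
  ⊗-id    : ∀ {k A B} → (id {k = k} {A = A} ⊗₁ id {k = k} {A = B}) ≈ id
  ⊗-∘     : ∀ {k A B C A' B' C'} {f : Hom k B C} {g : Hom k A B}
              {f' : Hom k B' C'} {g' : Hom k A' B'} →
            ((f ∘ g) ⊗₁ (f' ∘ g')) ≈ ((f ⊗₁ f') ∘ (g ⊗₁ g'))
  ⊙-id    : ∀ {k A B} → (id {k = k} {A = A} ⊙₁ id {k = k} {A = B}) ≈ id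
  ⊙-∘     : ∀ {k A B C A' B' C'} {f : Hom k B C} {g : Hom k A B}
              {f' : Hom k B' C'} {g' : Hom k A' B'} →
            ((f ∘ g) ⊙₁ (f' ∘ g')) ≈ ((f ⊙₁ f') ∘ (g ⊙₁ g'))
  α-nat   : ∀ {k A B C A' B' C'} {f : Hom k A A'} {g : Hom k B B'} {h : Hom k C C'} →
            (α ∘ (f ⊗₁ (g ⊗₁ h))) ≈ (((f ⊗₁ g) ⊗₁ h) ∘ α)
  ᾱ-nat   : ∀ {k A B C A' B' C'} {f : Hom k A A'} {g : Hom k B B'} {h : Hom k C C'} →
            (ᾱ ∘ (f ⊙₁ (g ⊙₁ h))) ≈ (((f ⊙₁ g) ⊙₁ h) ∘ ᾱ)
  δˡ-nat  : ∀ {k A B C A' B' C'} {f : Hom k A A'} {g : Hom k B B'} {h : Hom k C C'} →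
            (δˡ ∘ (f ⊗₁ (g ⊙₁ h))) ≈ (((f ⊗₁ g) ⊙₁ h) ∘ δˡ)
  δʳ-nat  : ∀ {k A B C A' B' C'} {f : Hom k A A'} {g : Hom k B B'} {h : Hom k C C'} →
            (δʳ ∘ ((f ⊙₁ g) ⊗₁ h)) ≈ ((f ⊙₁ (g ⊗₁ h)) ∘ δʳ)
  α-inv₁  : ∀ {A B C : Ob S} → (α⁻¹ {A = A} {B = B} {C = C} ∘ α) ≈ id
  α-inv₂  : ∀ {A B C : Ob S} → (α ∘ α⁻¹ {A = A} {B = B} {C = C}) ≈ id
  ᾱ-inv₁  : ∀ {A B C : Ob S} → (ᾱ⁻¹ {A = A} {B = B} {C = C} ∘ ᾱ) ≈ id
  ᾱ-inv₂  : ∀ {A B C : Ob S} → (ᾱ ∘ ᾱ⁻¹ {A = A} {B = B} {C = C}) ≈ id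
  P1 : ∀ {k} {A B C D : Ob S} →
       (α {k = k} {A = A ⊗ B} {B = C} {C = D} ∘ α {k = k} {A = A} {B = B} {C = C ⊗ D})
       ≈ ((α {k = k} {A = A} {B = B} {C = C} ⊗₁ id {k = k} {A = D}) ∘ α {k = k} {A = A} {B = B ⊗ C} {C = D}
           ∘ (id {k = k} {A = A} ⊗₁ α {k = k} {A = B} {B = C} {C = D}))
  P2 : ∀ {k} {A B C D : Ob S} →
       (δˡ {k = k} {A = A ⊗ B} {B = C} {C = D} ∘ α {k = k} {A = A} {B = B} {C = C ⊙ D})
       ≈ ((α {k = k} {A = A} {B = B} {C = C} ⊙₁ id {k = k} {A = D}) ∘ δˡ {k = k} {A = A} {B = B ⊗ C} {C = D}
           ∘ (id {k = k} {A = A} ⊗₁ δˡ {k = k} {A = B} {B = C} {C = D}))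
  P3 : ∀ {k} {A B C D : Ob S} →
       (δˡ {k = k} {A = A} {B = B} {C = C ⊗ D} ∘ (id {k = k} {A = A} ⊗₁ δʳ {k = k} {A = B} {B = C} {C = D}))
       ≈ (δʳ {k = k} {A = A ⊗ B} {B = C} {C = D} ∘ (δˡ {k = k} {A = A} {B = B} {C = C} ⊗₁ id {k = k} {A = D})
           ∘ α {k = k} {A = A} {B = B ⊙ C} {C = D})
  P4 : ∀ {k} {A B C D : Ob S} →
       (ᾱ {k = k} {A = A ⊗ B} {B = C} {C = D} ∘ δˡ {k = k} {A = A} {B = B} {C = C ⊙ D})
       ≈ ((δˡ {k = k} {A = A} {B = B} {C = C} ⊙₁ id {k = k} {A = D}) ∘ δˡ {k = k} {A = A} {B = B ⊙ C} {C = D}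
           ∘ (id {k = k} {A = A} ⊗₁ ᾱ {k = k} {A = B} {B = C} {C = D}))
  P5 : ∀ {k} {A B C D : Ob S} →
       ((id {k = k} {A = A} ⊙₁ α {k = k} {A = B} {B = C} {C = D}) ∘ δʳ {k = k} {A = A} {B = B} {C = C ⊗ D})
       ≈ (δʳ {k = k} {A = A} {B = B ⊗ C} {C = D} ∘ (δʳ {k = k} {A = A} {B = B} {C = C} ⊗₁ id {k = k} {A = D})
           ∘ α {k = k} {A = A ⊙ B} {B = C} {C = D})
  P6 : ∀ {k} {A B C D : Ob S} →
       ((δʳ {k = k} {A = A} {B = B} {C = C} ⊙₁ id {k = k} {A = D}) ∘ δˡ {k = k} {A = A ⊙ B} {B = C} {C = D})
       ≈ (ᾱ {k = k} {A = A} {B = B ⊗ C} {C = D} ∘ (id {k = k} {A = A} ⊙₁ δˡ {k = k} {A = B} {B = C} {C = D})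
           ∘ δʳ {k = k} {A = A} {B = B} {C = C ⊙ D})
  P7 : ∀ {k} {A B C D : Ob S} →
       (δʳ {k = k} {A = A ⊙ B} {B = C} {C = D} ∘ (ᾱ {k = k} {A = A} {B = B} {C = C} ⊗₁ id {k = k} {A = D}))
       ≈ (ᾱ {k = k} {A = A} {B = B} {C = C ⊗ D} ∘ (id {k = k} {A = A} ⊙₁ δʳ {k = k} {A = B} {B = C} {C = D})
           ∘ δʳ {k = k} {A = A} {B = B ⊙ C} {C = D})
  P8 : ∀ {k} {A B C D : Ob S} →
       (ᾱ {k = k} {A = A ⊙ B} {B = C} {C = D} ∘ ᾱ {k = k} {A = A} {B = B} {C = C ⊙ D})
       ≈ ((ᾱ {k = k} {A = A} {B = B} {C = C} ⊙₁ id {k = k} {A = D}) ∘ ᾱ {k = k} {A = A} {B = B ⊙ C} {C = D}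
           ∘ (id {k = k} {A = A} ⊙₁ ᾱ {k = k} {A = B} {B = C} {C = D}))

infix 4 _≈_

FreeThin : Kind → Set → Set
FreeThin k S = ∀ {A B : Ob S} (f g : Hom k A B) → f ≈ g

module Submission where

open import Level using (0ℓ)
open import Data.Empty using (⊥-elim)
open import Data.Nat using (ℕ; _+_; _<_; _≮_; z<s)
open import Data.Nat.Properties using (+-assoc; +-cancelˡ-≡; m<m+n; m+n≮m; <⇒≢; ≤-trans; m≤m+n)
open import Data.Product using (_×_; _,_; Σ-syntax; ∃₂)
open import Relation.Binary.Bundles using (Setoid)
open import Relation.Binary.PropositionalEquality using (_≡_; _≢_; refl; sym; trans; cong; cong₂; subst)
import Relation.Binary.Reasoning.Setoid as SetoidReasoning

open import Defs

-- Call a morphism A → B canonical if it is built by recursion on B: to reach B₁ ⊗ B₂ (or B₁ ⊙ B₂),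
-- first split A as L ⊗ R (or L ⊙ R) by the structural map that only reassociates A around the
-- chosen position (using α, and α⁻¹ in the strong case; a ⊙-split may also cross ⊗-nodes by δˡ and
-- δʳ), then continue canonically from L to B₁ and from R to B₂. Identities and generators are
-- canonical, and so are ⊗ and ⊙ of canonical maps. For composites it suffices to pull a split of
-- the target of a canonical map back to its source; by induction this comes down to splitting one
-- part of a split again, and two successive splits can always be traded for two others. Each case
-- of this interchange is one of the axioms (P1)–(P8), possibly with α or ᾱ inverted, so every
-- morphism equals a canonical one. Finally, a split is determined by the number of leaves to its
-- left and canonical maps preserve leaves, so parallel canonical maps coincide.

module _ {S : Set} where

  private variable
    k : Kind
    A B C D L L′ M Q R R′ W X X₁ X₂ Y Z : Ob S
    f f′ g g′ h h′ i j h₁ h₂ w₁ w₂ r s s′ t t′ : Hom k A B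

  Hom-setoid : Kind → Ob S → Ob S → Setoid 0ℓ 0ℓ
  Hom-setoid k A B = record
    { Carrier = Hom k A B
    ; _≈_ = _≈_
    ; isEquivalence = record { refl = ≈-refl ; sym = ≈-sym ; trans = ≈-trans }
    }

  module HomReasoning {k : Kind} {A B : Ob S} = SetoidReasoning (Hom-setoid k A B)
  open HomReasoning

  infixr 4 _⟩∘⟨_ refl⟩∘⟨_
  infixl 5 _⟩∘⟨refl

  _⟩∘⟨_ : f ≈ f′ → g ≈ g′ → f ∘ g ≈ f′ ∘ g′
  _⟩∘⟨_ = ∘-cong

  refl⟩∘⟨_ : g ≈ g′ → f ∘ g ≈ f ∘ g′
  refl⟩∘⟨_ = ∘-cong ≈-refl

  _⟩∘⟨refl : f ≈ f′ → f ∘ g ≈ f′ ∘ g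
  p ⟩∘⟨refl = ∘-cong p ≈-refl

  sym-assoc : f ∘ (g ∘ h) ≈ (f ∘ g) ∘ h
  sym-assoc = ≈-sym assoc

  pullˡ : f ∘ g ≈ h → f ∘ (g ∘ i) ≈ h ∘ i
  pullˡ p = ≈-trans sym-assoc (p ⟩∘⟨refl)

  pull³ : f ∘ (g ∘ h) ≈ f′ → f ∘ (g ∘ (h ∘ i)) ≈ f′ ∘ i
  pull³ p = ≈-trans (refl⟩∘⟨ sym-assoc) (pullˡ p)

  cancelˡ : f ∘ g ≈ id → f ∘ (g ∘ h) ≈ h
  cancelˡ p = ≈-trans (pullˡ p) idˡ

  cancelʳ : f ∘ g ≈ id → (h ∘ f) ∘ g ≈ h
  cancelʳ p = ≈-trans assoc (≈-trans (refl⟩∘⟨ p) idʳ)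

  extendʳ : f ∘ g ≈ h ∘ i → f ∘ (g ∘ j) ≈ h ∘ (i ∘ j)
  extendʳ p = ≈-trans (pullˡ p) assoc

  conjugate : g′ ∘ g ≈ id → h ∘ h′ ≈ id → g ∘ f ≈ i ∘ h → f ∘ h′ ≈ g′ ∘ i
  conjugate g′∘g h∘h′ e =
    ≈-trans (≈-sym (cancelˡ g′∘g)) (refl⟩∘⟨ ≈-trans (pullˡ e) (cancelʳ h∘h′))

  inverse-unique : g′ ∘ f ≈ id → f ∘ g ≈ id → g′ ≈ g
  inverse-unique {g′ = g′} {f = f} {g = g} g′∘f f∘g = begin
    g′              ≈⟨ idʳ ⟨
    g′ ∘ id         ≈⟨ refl⟩∘⟨ f∘g ⟨
    g′ ∘ f ∘ g      ≈⟨ pullˡ g′∘f ⟩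
    id ∘ g          ≈⟨ idˡ ⟩
    g               ∎

  moveʳ : f ∘ g ≈ id → h ∘ f ≈ i → h ≈ i ∘ g
  moveʳ p q = ≈-trans (≈-sym idʳ) (≈-trans (refl⟩∘⟨ ≈-sym p) (pullˡ q))

  -- Bifunctors with a pentagonal associator

  module Bifunctor
    {k : Kind}
    (_⊛_ : Ob S → Ob S → Ob S)
    (_⊛₁_ : ∀ {A A′ B B′} → Hom k A A′ → Hom k B B′ → Hom k (A ⊛ B) (A′ ⊛ B′))
    (⊛-cong : ∀ {A A′ B B′} {f f′ : Hom k A A′} {g g′ : Hom k B B′} →
              f ≈ f′ → g ≈ g′ → (f ⊛₁ g) ≈ (f′ ⊛₁ g′))
    (⊛-id : ∀ {A B} → (id {A = A} ⊛₁ id {A = B}) ≈ id)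
    (⊛-∘ : ∀ {A B C A′ B′ C′} {f : Hom k B C} {g : Hom k A B}
             {f′ : Hom k B′ C′} {g′ : Hom k A′ B′} →
           ((f ∘ g) ⊛₁ (f′ ∘ g′)) ≈ ((f ⊛₁ f′) ∘ (g ⊛₁ g′)))
    where

    merge : (f ⊛₁ f′) ∘ (g ⊛₁ g′) ≈ (f ∘ g) ⊛₁ (f′ ∘ g′)
    merge = ≈-sym ⊛-∘

    split-compose : f ∘ g ≈ h → f′ ∘ g′ ≈ h′ → s ∘ i ≈ (g ⊛₁ g′) ∘ s′ →
                    ((f ⊛₁ f′) ∘ s) ∘ i ≈ (h ⊛₁ h′) ∘ s′
    split-compose e e′ e″ =
      ≈-trans assoc (≈-trans (refl⟩∘⟨ e″) (pullˡ (≈-trans merge (⊛-cong e e′))))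

    splitˡ : (f ∘ g) ⊛₁ id {A = C} ≈ (f ⊛₁ id) ∘ (g ⊛₁ id)
    splitˡ = ≈-trans (⊛-cong ≈-refl (≈-sym idˡ)) ⊛-∘

    splitʳ : id {A = C} ⊛₁ (f ∘ g) ≈ (id ⊛₁ f) ∘ (id ⊛₁ g)
    splitʳ = ≈-trans (⊛-cong (≈-sym idˡ) ≈-refl) ⊛-∘

    splitˡ³ : (f ∘ g ∘ h) ⊛₁ id {A = C} ≈ (f ⊛₁ id) ∘ (g ⊛₁ id) ∘ (h ⊛₁ id)
    splitˡ³ = ≈-trans splitˡ (refl⟩∘⟨ splitˡ)

    splitʳ³ : id {A = C} ⊛₁ (f ∘ g ∘ h) ≈ (id ⊛₁ f) ∘ (id ⊛₁ g) ∘ (id ⊛₁ h)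
    splitʳ³ = ≈-trans splitʳ (refl⟩∘⟨ splitʳ)

    absorbˡ : (f ⊛₁ g) ∘ (h ⊛₁ id) ≈ (f ∘ h) ⊛₁ g
    absorbˡ = ≈-trans merge (⊛-cong ≈-refl idʳ)

    absorbʳ : (f ⊛₁ g) ∘ (id ⊛₁ h) ≈ f ⊛₁ (g ∘ h)
    absorbʳ = ≈-trans merge (⊛-cong idʳ ≈-refl)

    first∘second : g ≈ id → (f ⊛₁ g) ∘ (id ⊛₁ h) ≈ f ⊛₁ h
    first∘second g≈id = ≈-trans merge (⊛-cong idʳ (≈-trans (g≈id ⟩∘⟨refl) idˡ))

    second∘first : g ≈ id → (g ⊛₁ h) ∘ (f ⊛₁ id) ≈ f ⊛₁ h
    second∘first g≈id = ≈-trans merge (⊛-cong (≈-trans (g≈id ⟩∘⟨refl) idˡ) idʳ)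

    inverseˡ : f ∘ g ≈ id → (f ⊛₁ id {A = C}) ∘ (g ⊛₁ id) ≈ id
    inverseˡ p = ≈-trans merge (≈-trans (⊛-cong p idˡ) ⊛-id)

    inverseʳ : f ∘ g ≈ id → (id {A = C} ⊛₁ f) ∘ (id ⊛₁ g) ≈ id
    inverseʳ p = ≈-trans merge (≈-trans (⊛-cong idˡ p) ⊛-id)

    id⊛id∘ : (id ⊛₁ id) ∘ f ≈ f
    id⊛id∘ = ≈-trans (⊛-id ⟩∘⟨refl) idˡ

    module Associator
      (a : ∀ {A B C} → Hom k (A ⊛ (B ⊛ C)) ((A ⊛ B) ⊛ C))
      (a-natural : ∀ {A B C A′ B′ C′} {f : Hom k A A′} {g : Hom k B B′} {h : Hom k C C′} →
                   a ∘ (f ⊛₁ (g ⊛₁ h)) ≈ ((f ⊛₁ g) ⊛₁ h) ∘ a)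
      (pentagon : ∀ {A B C D} →
                  a {A ⊛ B} {C} {D} ∘ a {A} {B} {C ⊛ D}
                  ≈ (a {A} {B} {C} ⊛₁ id {A = D}) ∘ a {A} {B ⊛ C} {D} ∘ (id {A = A} ⊛₁ a {B} {C} {D}))
      where

      -- resplitʳ-x-y and resplitˡ-x-y are the cases of the interchange functions resplitʳ⊗, resplitˡ⊙, …
      -- below in which the two splits have shapes x and y.
      RightResplit : Hom k A (X ⊛ R) → Hom k R (Y ⊛ Z) → Hom k A (L ⊛ Z) → Hom k L (X ⊛ Y) → Set
      RightResplit s t s′ t′ = a ∘ (id ⊛₁ t) ∘ s ≈ (t′ ⊛₁ id) ∘ s′

      resplitʳ-here : RightResplit (id {A = X ⊛ R}) t (a ∘ (id ⊛₁ t)) id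
      resplitʳ-here = ≈-trans (refl⟩∘⟨ idʳ) (≈-sym id⊛id∘)

      resplitʳ-⊛ʳ : RightResplit s t s′ t′ →
                    RightResplit (a ∘ (id {A = W} ⊛₁ s)) t (a ∘ (id ⊛₁ s′)) (a ∘ (id ⊛₁ t′))
      resplitʳ-⊛ʳ {s = s} {t = t} {s′ = s′} {t′ = t′} e = begin
        a ∘ (id ⊛₁ t) ∘ a ∘ (id ⊛₁ s)
          ≈⟨ refl⟩∘⟨ ⊛-cong ⊛-id ≈-refl ⟩∘⟨refl ⟨
        a ∘ ((id ⊛₁ id) ⊛₁ t) ∘ a ∘ (id ⊛₁ s)
          ≈⟨ refl⟩∘⟨ extendʳ a-natural ⟨
        a ∘ a ∘ (id ⊛₁ (id ⊛₁ t)) ∘ (id ⊛₁ s)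
          ≈⟨ pullˡ pentagon ⟩
        ((a ⊛₁ id) ∘ a ∘ (id ⊛₁ a)) ∘ (id ⊛₁ (id ⊛₁ t)) ∘ (id ⊛₁ s)
          ≈⟨ ≈-trans assoc (refl⟩∘⟨ assoc) ⟩
        (a ⊛₁ id) ∘ a ∘ (id ⊛₁ a) ∘ (id ⊛₁ (id ⊛₁ t)) ∘ (id ⊛₁ s)
          ≈⟨ refl⟩∘⟨ refl⟩∘⟨ splitʳ³ ⟨
        (a ⊛₁ id) ∘ a ∘ (id ⊛₁ (a ∘ (id ⊛₁ t) ∘ s))
          ≈⟨ refl⟩∘⟨ refl⟩∘⟨ ⊛-cong ≈-refl e ⟩
        (a ⊛₁ id) ∘ a ∘ (id ⊛₁ ((t′ ⊛₁ id) ∘ s′))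
          ≈⟨ refl⟩∘⟨ refl⟩∘⟨ splitʳ ⟩
        (a ⊛₁ id) ∘ a ∘ (id ⊛₁ (t′ ⊛₁ id)) ∘ (id ⊛₁ s′)
          ≈⟨ refl⟩∘⟨ extendʳ a-natural ⟩
        (a ⊛₁ id) ∘ ((id ⊛₁ t′) ⊛₁ id) ∘ a ∘ (id ⊛₁ s′)
          ≈⟨ pullˡ (≈-sym splitˡ) ⟩
        ((a ∘ (id ⊛₁ t′)) ⊛₁ id) ∘ a ∘ (id ⊛₁ s′) ∎

      pull-⊛ʳ : t ∘ h₂ ≈ (w₁ ⊛₁ w₂) ∘ r → RightResplit s r s′ t′ →
                (a ∘ (id ⊛₁ t)) ∘ (h₁ ⊛₁ h₂) ∘ s ≈ (((h₁ ⊛₁ w₁) ∘ t′) ⊛₁ w₂) ∘ s′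
      pull-⊛ʳ {t = t} {h₂ = h₂} {w₁ = w₁} {w₂ = w₂} {r = r} {s = s} {s′ = s′} {t′ = t′} {h₁ = h₁}
              t-natural e = begin
        (a ∘ (id ⊛₁ t)) ∘ (h₁ ⊛₁ h₂) ∘ s
          ≈⟨ assoc ⟩
        a ∘ (id ⊛₁ t) ∘ (h₁ ⊛₁ h₂) ∘ s
          ≈⟨ refl⟩∘⟨ pullˡ (≈-trans merge (⊛-cong idˡ t-natural)) ⟩
        a ∘ (h₁ ⊛₁ ((w₁ ⊛₁ w₂) ∘ r)) ∘ s
          ≈⟨ refl⟩∘⟨ absorbʳ ⟩∘⟨refl ⟨
        a ∘ ((h₁ ⊛₁ (w₁ ⊛₁ w₂)) ∘ (id ⊛₁ r)) ∘ s
          ≈⟨ refl⟩∘⟨ assoc ⟩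
        a ∘ (h₁ ⊛₁ (w₁ ⊛₁ w₂)) ∘ (id ⊛₁ r) ∘ s
          ≈⟨ extendʳ a-natural ⟩
        ((h₁ ⊛₁ w₁) ⊛₁ w₂) ∘ a ∘ (id ⊛₁ r) ∘ s
          ≈⟨ refl⟩∘⟨ e ⟩
        ((h₁ ⊛₁ w₁) ⊛₁ w₂) ∘ (t′ ⊛₁ id) ∘ s′
          ≈⟨ pullˡ absorbˡ ⟩
        (((h₁ ⊛₁ w₁) ∘ t′) ⊛₁ w₂) ∘ s′ ∎

      module Invertible
        (b : ∀ {A B C} → Hom k ((A ⊛ B) ⊛ C) (A ⊛ (B ⊛ C)))
        (b∘a : ∀ {A B C} → b {A} {B} {C} ∘ a ≈ id)
        (a∘b : ∀ {A B C} → a ∘ b {A} {B} {C} ≈ id)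
        where

        b-natural : b ∘ ((f ⊛₁ g) ⊛₁ h) ≈ (f ⊛₁ (g ⊛₁ h)) ∘ b
        b-natural = ≈-sym (conjugate b∘a a∘b a-natural)

        pentagon⁻¹ : b {A} {B} {C ⊛ D} ∘ b {A ⊛ B} {C} {D} ≈ (id ⊛₁ b) ∘ b ∘ (b ⊛₁ id)
        pentagon⁻¹ = ≈-sym (inverse-unique left-inverse right-inverse)
          where
          right-inverse : (a ∘ a) ∘ (b ∘ b) ≈ id
          right-inverse = ≈-trans assoc (≈-trans (refl⟩∘⟨ cancelˡ a∘b) a∘b)

          left-inverse : ((id ⊛₁ b) ∘ b ∘ (b ⊛₁ id)) ∘ (a ∘ a) ≈ id
          left-inverse = begin
            ((id ⊛₁ b) ∘ b ∘ (b ⊛₁ id)) ∘ (a ∘ a)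
              ≈⟨ refl⟩∘⟨ pentagon ⟩
            ((id ⊛₁ b) ∘ b ∘ (b ⊛₁ id)) ∘ (a ⊛₁ id) ∘ a ∘ (id ⊛₁ a)
              ≈⟨ ≈-trans assoc (refl⟩∘⟨ assoc) ⟩
            (id ⊛₁ b) ∘ b ∘ (b ⊛₁ id) ∘ (a ⊛₁ id) ∘ a ∘ (id ⊛₁ a)
              ≈⟨ refl⟩∘⟨ refl⟩∘⟨ cancelˡ (inverseˡ b∘a) ⟩
            (id ⊛₁ b) ∘ b ∘ a ∘ (id ⊛₁ a)
              ≈⟨ refl⟩∘⟨ cancelˡ b∘a ⟩
            (id ⊛₁ b) ∘ (id ⊛₁ a)
              ≈⟨ inverseʳ b∘a ⟩
            id ∎

        pentagon₁ : (b {A} {B} {C} ⊛₁ id {A = D}) ∘ a ≈ a ∘ (id ⊛₁ a) ∘ b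
        pentagon₁ = ≈-trans (≈-sym (conjugate (inverseˡ b∘a) a∘b (≈-sym pentagon))) assoc

        pentagon₂ : b ∘ (a {A} {B} {C} ⊛₁ id {A = D}) ∘ a ≈ a ∘ (id ⊛₁ b)
        pentagon₂ = ≈-sym (conjugate b∘a (inverseʳ a∘b) (≈-trans pentagon sym-assoc))

        pentagon₃ : b ∘ (a {A} {B} {C} ⊛₁ id {A = D}) ≈ a ∘ (id ⊛₁ b) ∘ b
        pentagon₃ = ≈-trans (moveʳ a∘b assoc) (≈-trans (pentagon₂ ⟩∘⟨refl) assoc)

        pentagon₄ : b ∘ (b {A} {B} {C} ⊛₁ id {A = D}) ∘ a ≈ (id ⊛₁ a) ∘ b
        pentagon₄ = ≈-trans (refl⟩∘⟨ pentagon₁) (cancelˡ b∘a)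

        resplitʳ-⊛ˡ-here : RightResplit (b ∘ (s ⊛₁ id {A = W})) id id s
        resplitʳ-⊛ˡ-here = ≈-trans (refl⟩∘⟨ id⊛id∘) (≈-trans (cancelˡ a∘b) (≈-sym idʳ))

        resplitʳ-⊛ˡ-⊛ʳ : RightResplit (b ∘ (s ⊛₁ id)) (a ∘ (id ⊛₁ t)) (a ∘ (id ⊛₁ t)) (b ∘ (s ⊛₁ id))
        resplitʳ-⊛ˡ-⊛ʳ {s = s} {t = t} = begin
          a ∘ (id ⊛₁ (a ∘ (id ⊛₁ t))) ∘ b ∘ (s ⊛₁ id)
            ≈⟨ refl⟩∘⟨ splitʳ ⟩∘⟨refl ⟩
          a ∘ ((id ⊛₁ a) ∘ (id ⊛₁ (id ⊛₁ t))) ∘ b ∘ (s ⊛₁ id)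
            ≈⟨ refl⟩∘⟨ assoc ⟩
          a ∘ (id ⊛₁ a) ∘ (id ⊛₁ (id ⊛₁ t)) ∘ b ∘ (s ⊛₁ id)
            ≈⟨ refl⟩∘⟨ refl⟩∘⟨ extendʳ b-natural ⟨
          a ∘ (id ⊛₁ a) ∘ b ∘ ((id ⊛₁ id) ⊛₁ t) ∘ (s ⊛₁ id)
            ≈⟨ refl⟩∘⟨ refl⟩∘⟨ refl⟩∘⟨ second∘first ⊛-id ⟩
          a ∘ (id ⊛₁ a) ∘ b ∘ (s ⊛₁ t)
            ≈⟨ pull³ (≈-sym pentagon₁) ⟩
          ((b ⊛₁ id) ∘ a) ∘ (s ⊛₁ t)
            ≈⟨ assoc ⟩
          (b ⊛₁ id) ∘ a ∘ (s ⊛₁ t)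
            ≈⟨ refl⟩∘⟨ refl⟩∘⟨ first∘second ⊛-id ⟨
          (b ⊛₁ id) ∘ a ∘ (s ⊛₁ (id ⊛₁ id)) ∘ (id ⊛₁ t)
            ≈⟨ refl⟩∘⟨ extendʳ a-natural ⟩
          (b ⊛₁ id) ∘ ((s ⊛₁ id) ⊛₁ id) ∘ a ∘ (id ⊛₁ t)
            ≈⟨ pullˡ (≈-sym splitˡ) ⟩
          ((b ∘ (s ⊛₁ id)) ⊛₁ id) ∘ a ∘ (id ⊛₁ t) ∎

        resplitʳ-⊛ˡ-⊛ˡ : RightResplit s t s′ t′ →
                         RightResplit (b ∘ (s ⊛₁ id {A = W})) (b ∘ (t ⊛₁ id)) (b ∘ (s′ ⊛₁ id)) t′
        resplitʳ-⊛ˡ-⊛ˡ {s = s} {t = t} {s′ = s′} {t′ = t′} e = begin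
          a ∘ (id ⊛₁ (b ∘ (t ⊛₁ id))) ∘ b ∘ (s ⊛₁ id)
            ≈⟨ refl⟩∘⟨ splitʳ ⟩∘⟨refl ⟩
          a ∘ ((id ⊛₁ b) ∘ (id ⊛₁ (t ⊛₁ id))) ∘ b ∘ (s ⊛₁ id)
            ≈⟨ refl⟩∘⟨ assoc ⟩
          a ∘ (id ⊛₁ b) ∘ (id ⊛₁ (t ⊛₁ id)) ∘ b ∘ (s ⊛₁ id)
            ≈⟨ refl⟩∘⟨ refl⟩∘⟨ extendʳ b-natural ⟨
          a ∘ (id ⊛₁ b) ∘ b ∘ ((id ⊛₁ t) ⊛₁ id) ∘ (s ⊛₁ id)
            ≈⟨ pull³ (≈-sym pentagon₃) ⟩
          (b ∘ (a ⊛₁ id)) ∘ ((id ⊛₁ t) ⊛₁ id) ∘ (s ⊛₁ id)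
            ≈⟨ assoc ⟩
          b ∘ (a ⊛₁ id) ∘ ((id ⊛₁ t) ⊛₁ id) ∘ (s ⊛₁ id)
            ≈⟨ refl⟩∘⟨ splitˡ³ ⟨
          b ∘ ((a ∘ (id ⊛₁ t) ∘ s) ⊛₁ id)
            ≈⟨ refl⟩∘⟨ ⊛-cong e ≈-refl ⟩
          b ∘ (((t′ ⊛₁ id) ∘ s′) ⊛₁ id)
            ≈⟨ refl⟩∘⟨ splitˡ ⟩
          b ∘ ((t′ ⊛₁ id) ⊛₁ id) ∘ (s′ ⊛₁ id)
            ≈⟨ extendʳ b-natural ⟩
          (t′ ⊛₁ (id ⊛₁ id)) ∘ b ∘ (s′ ⊛₁ id)
            ≈⟨ ⊛-cong ≈-refl ⊛-id ⟩∘⟨refl ⟩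
          (t′ ⊛₁ id) ∘ b ∘ (s′ ⊛₁ id) ∎

        LeftResplit : Hom k A (X ⊛ R) → Hom k X (X₁ ⊛ X₂) → Hom k A (X₁ ⊛ Q) → Hom k Q (X₂ ⊛ R) → Set
        LeftResplit s t s′ t′ = b ∘ (t ⊛₁ id) ∘ s ≈ (id ⊛₁ t′) ∘ s′

        resplitˡ-here : LeftResplit (id {A = X ⊛ R}) t (b ∘ (t ⊛₁ id)) id
        resplitˡ-here = ≈-trans (refl⟩∘⟨ idʳ) (≈-sym id⊛id∘)

        resplitˡ-⊛ˡ : LeftResplit s t s′ t′ →
                      LeftResplit (b ∘ (s ⊛₁ id {A = W})) t (b ∘ (s′ ⊛₁ id)) (b ∘ (t′ ⊛₁ id))
        resplitˡ-⊛ˡ {s = s} {t = t} {s′ = s′} {t′ = t′} e = begin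
          b ∘ (t ⊛₁ id) ∘ b ∘ (s ⊛₁ id)
            ≈⟨ refl⟩∘⟨ ⊛-cong ≈-refl ⊛-id ⟩∘⟨refl ⟨
          b ∘ (t ⊛₁ (id ⊛₁ id)) ∘ b ∘ (s ⊛₁ id)
            ≈⟨ refl⟩∘⟨ extendʳ b-natural ⟨
          b ∘ b ∘ ((t ⊛₁ id) ⊛₁ id) ∘ (s ⊛₁ id)
            ≈⟨ refl⟩∘⟨ refl⟩∘⟨ splitˡ ⟨
          b ∘ b ∘ (((t ⊛₁ id) ∘ s) ⊛₁ id)
            ≈⟨ pullˡ pentagon⁻¹ ⟩
          ((id ⊛₁ b) ∘ b ∘ (b ⊛₁ id)) ∘ (((t ⊛₁ id) ∘ s) ⊛₁ id)
            ≈⟨ ≈-trans assoc (refl⟩∘⟨ assoc) ⟩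
          (id ⊛₁ b) ∘ b ∘ (b ⊛₁ id) ∘ (((t ⊛₁ id) ∘ s) ⊛₁ id)
            ≈⟨ refl⟩∘⟨ refl⟩∘⟨ splitˡ ⟨
          (id ⊛₁ b) ∘ b ∘ ((b ∘ (t ⊛₁ id) ∘ s) ⊛₁ id)
            ≈⟨ refl⟩∘⟨ refl⟩∘⟨ ⊛-cong e ≈-refl ⟩
          (id ⊛₁ b) ∘ b ∘ (((id ⊛₁ t′) ∘ s′) ⊛₁ id)
            ≈⟨ refl⟩∘⟨ refl⟩∘⟨ splitˡ ⟩
          (id ⊛₁ b) ∘ b ∘ ((id ⊛₁ t′) ⊛₁ id) ∘ (s′ ⊛₁ id)
            ≈⟨ refl⟩∘⟨ extendʳ b-natural ⟩
          (id ⊛₁ b) ∘ (id ⊛₁ (t′ ⊛₁ id)) ∘ b ∘ (s′ ⊛₁ id)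
            ≈⟨ pullˡ (≈-sym splitʳ) ⟩
          (id ⊛₁ (b ∘ (t′ ⊛₁ id))) ∘ b ∘ (s′ ⊛₁ id) ∎

        resplitˡ-⊛ʳ-here : LeftResplit (a ∘ (id {A = W} ⊛₁ s)) id id s
        resplitˡ-⊛ʳ-here = ≈-trans (refl⟩∘⟨ id⊛id∘) (≈-trans (cancelˡ b∘a) (≈-sym idʳ))

        resplitˡ-⊛ʳ-⊛ʳ : LeftResplit s t s′ t′ →
                         LeftResplit (a ∘ (id {A = W} ⊛₁ s)) (a ∘ (id ⊛₁ t)) (a ∘ (id ⊛₁ s′)) t′
        resplitˡ-⊛ʳ-⊛ʳ {s = s} {t = t} {s′ = s′} {t′ = t′} e = begin
          b ∘ ((a ∘ (id ⊛₁ t)) ⊛₁ id) ∘ a ∘ (id ⊛₁ s)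
            ≈⟨ refl⟩∘⟨ splitˡ ⟩∘⟨refl ⟩
          b ∘ ((a ⊛₁ id) ∘ ((id ⊛₁ t) ⊛₁ id)) ∘ a ∘ (id ⊛₁ s)
            ≈⟨ refl⟩∘⟨ assoc ⟩
          b ∘ (a ⊛₁ id) ∘ ((id ⊛₁ t) ⊛₁ id) ∘ a ∘ (id ⊛₁ s)
            ≈⟨ refl⟩∘⟨ refl⟩∘⟨ extendʳ a-natural ⟨
          b ∘ (a ⊛₁ id) ∘ a ∘ (id ⊛₁ (t ⊛₁ id)) ∘ (id ⊛₁ s)
            ≈⟨ refl⟩∘⟨ refl⟩∘⟨ refl⟩∘⟨ splitʳ ⟨
          b ∘ (a ⊛₁ id) ∘ a ∘ (id ⊛₁ ((t ⊛₁ id) ∘ s))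
            ≈⟨ pull³ pentagon₂ ⟩
          (a ∘ (id ⊛₁ b)) ∘ (id ⊛₁ ((t ⊛₁ id) ∘ s))
            ≈⟨ assoc ⟩
          a ∘ (id ⊛₁ b) ∘ (id ⊛₁ ((t ⊛₁ id) ∘ s))
            ≈⟨ refl⟩∘⟨ splitʳ ⟨
          a ∘ (id ⊛₁ (b ∘ (t ⊛₁ id) ∘ s))
            ≈⟨ refl⟩∘⟨ ⊛-cong ≈-refl e ⟩
          a ∘ (id ⊛₁ ((id ⊛₁ t′) ∘ s′))
            ≈⟨ refl⟩∘⟨ splitʳ ⟩
          a ∘ (id ⊛₁ (id ⊛₁ t′)) ∘ (id ⊛₁ s′)
            ≈⟨ extendʳ a-natural ⟩
          ((id ⊛₁ id) ⊛₁ t′) ∘ a ∘ (id ⊛₁ s′)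
            ≈⟨ ⊛-cong ⊛-id ≈-refl ⟩∘⟨refl ⟩
          (id ⊛₁ t′) ∘ a ∘ (id ⊛₁ s′) ∎

        resplitˡ-⊛ʳ-⊛ˡ : LeftResplit (a ∘ (id ⊛₁ s)) (b ∘ (t ⊛₁ id)) (b ∘ (t ⊛₁ id)) (a ∘ (id ⊛₁ s))
        resplitˡ-⊛ʳ-⊛ˡ {s = s} {t = t} = begin
          b ∘ ((b ∘ (t ⊛₁ id)) ⊛₁ id) ∘ a ∘ (id ⊛₁ s)
            ≈⟨ refl⟩∘⟨ splitˡ ⟩∘⟨refl ⟩
          b ∘ ((b ⊛₁ id) ∘ ((t ⊛₁ id) ⊛₁ id)) ∘ a ∘ (id ⊛₁ s)
            ≈⟨ refl⟩∘⟨ assoc ⟩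
          b ∘ (b ⊛₁ id) ∘ ((t ⊛₁ id) ⊛₁ id) ∘ a ∘ (id ⊛₁ s)
            ≈⟨ refl⟩∘⟨ refl⟩∘⟨ extendʳ a-natural ⟨
          b ∘ (b ⊛₁ id) ∘ a ∘ (t ⊛₁ (id ⊛₁ id)) ∘ (id ⊛₁ s)
            ≈⟨ refl⟩∘⟨ refl⟩∘⟨ refl⟩∘⟨ first∘second ⊛-id ⟩
          b ∘ (b ⊛₁ id) ∘ a ∘ (t ⊛₁ s)
            ≈⟨ pull³ pentagon₄ ⟩
          ((id ⊛₁ a) ∘ b) ∘ (t ⊛₁ s)
            ≈⟨ assoc ⟩
          (id ⊛₁ a) ∘ b ∘ (t ⊛₁ s)
            ≈⟨ refl⟩∘⟨ refl⟩∘⟨ second∘first ⊛-id ⟨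
          (id ⊛₁ a) ∘ b ∘ ((id ⊛₁ id) ⊛₁ s) ∘ (t ⊛₁ id)
            ≈⟨ refl⟩∘⟨ extendʳ b-natural ⟩
          (id ⊛₁ a) ∘ (id ⊛₁ (id ⊛₁ s)) ∘ b ∘ (t ⊛₁ id)
            ≈⟨ pullˡ (≈-sym splitʳ) ⟩
          (id ⊛₁ (a ∘ (id ⊛₁ s))) ∘ b ∘ (t ⊛₁ id) ∎

        pull-⊛ˡ : t ∘ h₁ ≈ (w₁ ⊛₁ w₂) ∘ r → LeftResplit s r s′ t′ →
                  (b ∘ (t ⊛₁ id)) ∘ (h₁ ⊛₁ h₂) ∘ s ≈ (w₁ ⊛₁ ((w₂ ⊛₁ h₂) ∘ t′)) ∘ s′
        pull-⊛ˡ {t = t} {h₁ = h₁} {w₁ = w₁} {w₂ = w₂} {r = r} {s = s} {s′ = s′} {t′ = t′} {h₂ = h₂}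
                t-natural e = begin
          (b ∘ (t ⊛₁ id)) ∘ (h₁ ⊛₁ h₂) ∘ s
            ≈⟨ assoc ⟩
          b ∘ (t ⊛₁ id) ∘ (h₁ ⊛₁ h₂) ∘ s
            ≈⟨ refl⟩∘⟨ pullˡ (≈-trans merge (⊛-cong t-natural idˡ)) ⟩
          b ∘ (((w₁ ⊛₁ w₂) ∘ r) ⊛₁ h₂) ∘ s
            ≈⟨ refl⟩∘⟨ absorbˡ ⟩∘⟨refl ⟨
          b ∘ (((w₁ ⊛₁ w₂) ⊛₁ h₂) ∘ (r ⊛₁ id)) ∘ s
            ≈⟨ refl⟩∘⟨ assoc ⟩
          b ∘ ((w₁ ⊛₁ w₂) ⊛₁ h₂) ∘ (r ⊛₁ id) ∘ s
            ≈⟨ extendʳ b-natural ⟩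
          (w₁ ⊛₁ (w₂ ⊛₁ h₂)) ∘ b ∘ (r ⊛₁ id) ∘ s
            ≈⟨ refl⟩∘⟨ e ⟩
          (w₁ ⊛₁ (w₂ ⊛₁ h₂)) ∘ (id ⊛₁ t′) ∘ s′
            ≈⟨ pullˡ absorbʳ ⟩
          (w₁ ⊛₁ ((w₂ ⊛₁ h₂) ∘ t′)) ∘ s′ ∎

  module Tensor {k : Kind} = Bifunctor {k} _⊗_ _⊗₁_ ⊗-cong ⊗-id ⊗-∘
  module Par {k : Kind} = Bifunctor {k} _⊙_ _⊙₁_ ⊙-cong ⊙-id ⊙-∘
  module TensorAssoc {k : Kind} = Tensor.Associator {k} α α-nat P1
  module ParAssoc {k : Kind} = Par.Associator {k} ᾱ ᾱ-nat P8
  module TensorIso = TensorAssoc.Invertible {strong} α⁻¹ α-inv₁ α-inv₂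
  module ParIso = ParAssoc.Invertible {strong} ᾱ⁻¹ ᾱ-inv₁ ᾱ-inv₂

  -- The distributors

  P2⁻¹ : δˡ ∘ (id ⊗₁ δˡ) ∘ α⁻¹ ≈ (α⁻¹ ⊙₁ id) ∘ δˡ {A = A ⊗ B} {B = C} {C = D}
  P2⁻¹ = ≈-trans sym-assoc (conjugate (Par.inverseˡ α-inv₁) α-inv₂ (≈-sym P2))

  P3⁻¹ : δˡ ∘ (id ⊗₁ δʳ) ∘ α⁻¹ ≈ δʳ ∘ (δˡ {A = A} {B = B} {C = C} ⊗₁ id {A = D})
  P3⁻¹ = ≈-trans (pullˡ P3) (≈-trans assoc (refl⟩∘⟨ cancelʳ α-inv₂))

  P4⁻¹ : ᾱ⁻¹ ∘ (δˡ ⊙₁ id) ∘ δˡ ≈ δˡ {A = A} ∘ (id ⊗₁ ᾱ⁻¹ {A = B} {B = C} {C = D})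
  P4⁻¹ = ≈-sym (conjugate ᾱ-inv₁ (Tensor.inverseʳ ᾱ-inv₂) (≈-trans P4 sym-assoc))

  P5⁻¹ : δʳ ∘ α⁻¹ ≈ (id ⊙₁ α⁻¹) ∘ δʳ ∘ (δʳ {A = A} {B = B} {C = C} ⊗₁ id {A = D})
  P5⁻¹ = conjugate (Par.inverseʳ α-inv₁) α-inv₂ (≈-trans P5 sym-assoc)

  P6⁻¹ : ᾱ⁻¹ ∘ (δʳ ⊙₁ id) ∘ δˡ ≈ (id ⊙₁ δˡ) ∘ δʳ {A = A} {B = B} {C = C ⊙ D}
  P6⁻¹ = ≈-trans (refl⟩∘⟨ P6) (cancelˡ ᾱ-inv₁)

  P7⁻¹ : ᾱ⁻¹ ∘ δʳ ≈ (id ⊙₁ δʳ) ∘ δʳ ∘ (ᾱ⁻¹ {A = A} {B = B} {C = C} ⊗₁ id {A = D})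
  P7⁻¹ = ≈-trans (≈-sym (conjugate ᾱ-inv₁ (Tensor.inverseˡ ᾱ-inv₂) (≈-sym P7))) assoc

  LeftResplit⊗⊙ : Hom k A (X ⊗ R) → Hom k X (X₁ ⊙ X₂) → Hom k A (X₁ ⊙ Q) → Hom k Q (X₂ ⊗ R) → Set
  LeftResplit⊗⊙ s t s′ t′ = δʳ ∘ (t ⊗₁ id) ∘ s ≈ (id ⊙₁ t′) ∘ s′

  resplitˡ⊗⊙-here : LeftResplit⊗⊙ (id {A = X ⊗ R}) t (δʳ ∘ (t ⊗₁ id)) id
  resplitˡ⊗⊙-here = ≈-trans (refl⟩∘⟨ idʳ) (≈-sym Par.id⊛id∘)

  resplitˡ⊗⊙-⊗ʳ-⊗ˡ : LeftResplit⊗⊙ (α ∘ (id ⊗₁ s)) (δʳ ∘ (t ⊗₁ id)) (δʳ ∘ (t ⊗₁ id)) (α ∘ (id ⊗₁ s))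
  resplitˡ⊗⊙-⊗ʳ-⊗ˡ {s = s} {t = t} = begin
    δʳ ∘ ((δʳ ∘ (t ⊗₁ id)) ⊗₁ id) ∘ α ∘ (id ⊗₁ s)
      ≈⟨ refl⟩∘⟨ Tensor.splitˡ ⟩∘⟨refl ⟩
    δʳ ∘ ((δʳ ⊗₁ id) ∘ ((t ⊗₁ id) ⊗₁ id)) ∘ α ∘ (id ⊗₁ s)
      ≈⟨ refl⟩∘⟨ assoc ⟩
    δʳ ∘ (δʳ ⊗₁ id) ∘ ((t ⊗₁ id) ⊗₁ id) ∘ α ∘ (id ⊗₁ s)
      ≈⟨ refl⟩∘⟨ refl⟩∘⟨ extendʳ α-nat ⟨
    δʳ ∘ (δʳ ⊗₁ id) ∘ α ∘ (t ⊗₁ (id ⊗₁ id)) ∘ (id ⊗₁ s)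
      ≈⟨ refl⟩∘⟨ refl⟩∘⟨ refl⟩∘⟨ Tensor.first∘second ⊗-id ⟩
    δʳ ∘ (δʳ ⊗₁ id) ∘ α ∘ (t ⊗₁ s)
      ≈⟨ pull³ (≈-sym P5) ⟩
    ((id ⊙₁ α) ∘ δʳ) ∘ (t ⊗₁ s)
      ≈⟨ assoc ⟩
    (id ⊙₁ α) ∘ δʳ ∘ (t ⊗₁ s)
      ≈⟨ refl⟩∘⟨ refl⟩∘⟨ Tensor.second∘first ⊙-id ⟨
    (id ⊙₁ α) ∘ δʳ ∘ ((id ⊙₁ id) ⊗₁ s) ∘ (t ⊗₁ id)
      ≈⟨ refl⟩∘⟨ extendʳ δʳ-nat ⟩
    (id ⊙₁ α) ∘ (id ⊙₁ (id ⊗₁ s)) ∘ δʳ ∘ (t ⊗₁ id)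
      ≈⟨ pullˡ (≈-sym Par.splitʳ) ⟩
    (id ⊙₁ (α ∘ (id ⊗₁ s))) ∘ δʳ ∘ (t ⊗₁ id) ∎

  resplitˡ⊗⊙-⊗ʳ-⊗ʳ : LeftResplit⊗⊙ s t s′ t′ →
                     LeftResplit⊗⊙ (α ∘ (id {A = W} ⊗₁ s)) (δˡ ∘ (id ⊗₁ t)) (δˡ ∘ (id ⊗₁ s′)) t′
  resplitˡ⊗⊙-⊗ʳ-⊗ʳ {s = s} {t = t} {s′ = s′} {t′ = t′} e = begin
    δʳ ∘ ((δˡ ∘ (id ⊗₁ t)) ⊗₁ id) ∘ α ∘ (id ⊗₁ s)
      ≈⟨ refl⟩∘⟨ Tensor.splitˡ ⟩∘⟨refl ⟩
    δʳ ∘ ((δˡ ⊗₁ id) ∘ ((id ⊗₁ t) ⊗₁ id)) ∘ α ∘ (id ⊗₁ s)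
      ≈⟨ refl⟩∘⟨ assoc ⟩
    δʳ ∘ (δˡ ⊗₁ id) ∘ ((id ⊗₁ t) ⊗₁ id) ∘ α ∘ (id ⊗₁ s)
      ≈⟨ refl⟩∘⟨ refl⟩∘⟨ extendʳ α-nat ⟨
    δʳ ∘ (δˡ ⊗₁ id) ∘ α ∘ (id ⊗₁ (t ⊗₁ id)) ∘ (id ⊗₁ s)
      ≈⟨ pull³ (≈-sym P3) ⟩
    (δˡ ∘ (id ⊗₁ δʳ)) ∘ (id ⊗₁ (t ⊗₁ id)) ∘ (id ⊗₁ s)
      ≈⟨ assoc ⟩
    δˡ ∘ (id ⊗₁ δʳ) ∘ (id ⊗₁ (t ⊗₁ id)) ∘ (id ⊗₁ s)
      ≈⟨ refl⟩∘⟨ Tensor.splitʳ³ ⟨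
    δˡ ∘ (id ⊗₁ (δʳ ∘ (t ⊗₁ id) ∘ s))
      ≈⟨ refl⟩∘⟨ ⊗-cong ≈-refl e ⟩
    δˡ ∘ (id ⊗₁ ((id ⊙₁ t′) ∘ s′))
      ≈⟨ refl⟩∘⟨ Tensor.splitʳ ⟩
    δˡ ∘ (id ⊗₁ (id ⊙₁ t′)) ∘ (id ⊗₁ s′)
      ≈⟨ extendʳ δˡ-nat ⟩
    ((id ⊗₁ id) ⊙₁ t′) ∘ δˡ ∘ (id ⊗₁ s′)
      ≈⟨ ⊙-cong ⊗-id ≈-refl ⟩∘⟨refl ⟩
    (id ⊙₁ t′) ∘ δˡ ∘ (id ⊗₁ s′) ∎

  resplitˡ⊗⊙-⊗ˡ : LeftResplit⊗⊙ s t s′ t′ →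
                  LeftResplit⊗⊙ (α⁻¹ ∘ (s ⊗₁ id {A = W})) t (δʳ ∘ (s′ ⊗₁ id)) (α⁻¹ ∘ (t′ ⊗₁ id))
  resplitˡ⊗⊙-⊗ˡ {s = s} {t = t} {s′ = s′} {t′ = t′} e = begin
    δʳ ∘ (t ⊗₁ id) ∘ α⁻¹ ∘ (s ⊗₁ id)
      ≈⟨ refl⟩∘⟨ ⊗-cong ≈-refl ⊗-id ⟩∘⟨refl ⟨
    δʳ ∘ (t ⊗₁ (id ⊗₁ id)) ∘ α⁻¹ ∘ (s ⊗₁ id)
      ≈⟨ refl⟩∘⟨ extendʳ TensorIso.b-natural ⟨
    δʳ ∘ α⁻¹ ∘ ((t ⊗₁ id) ⊗₁ id) ∘ (s ⊗₁ id)
      ≈⟨ refl⟩∘⟨ refl⟩∘⟨ Tensor.splitˡ ⟨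
    δʳ ∘ α⁻¹ ∘ (((t ⊗₁ id) ∘ s) ⊗₁ id)
      ≈⟨ pullˡ P5⁻¹ ⟩
    ((id ⊙₁ α⁻¹) ∘ δʳ ∘ (δʳ ⊗₁ id)) ∘ (((t ⊗₁ id) ∘ s) ⊗₁ id)
      ≈⟨ ≈-trans assoc (refl⟩∘⟨ assoc) ⟩
    (id ⊙₁ α⁻¹) ∘ δʳ ∘ (δʳ ⊗₁ id) ∘ (((t ⊗₁ id) ∘ s) ⊗₁ id)
      ≈⟨ refl⟩∘⟨ refl⟩∘⟨ Tensor.splitˡ ⟨
    (id ⊙₁ α⁻¹) ∘ δʳ ∘ ((δʳ ∘ (t ⊗₁ id) ∘ s) ⊗₁ id)
      ≈⟨ refl⟩∘⟨ refl⟩∘⟨ ⊗-cong e ≈-refl ⟩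
    (id ⊙₁ α⁻¹) ∘ δʳ ∘ (((id ⊙₁ t′) ∘ s′) ⊗₁ id)
      ≈⟨ refl⟩∘⟨ refl⟩∘⟨ Tensor.splitˡ ⟩
    (id ⊙₁ α⁻¹) ∘ δʳ ∘ ((id ⊙₁ t′) ⊗₁ id) ∘ (s′ ⊗₁ id)
      ≈⟨ refl⟩∘⟨ extendʳ δʳ-nat ⟩
    (id ⊙₁ α⁻¹) ∘ (id ⊙₁ (t′ ⊗₁ id)) ∘ δʳ ∘ (s′ ⊗₁ id)
      ≈⟨ pullˡ (≈-sym Par.splitʳ) ⟩
    (id ⊙₁ (α⁻¹ ∘ (t′ ⊗₁ id))) ∘ δʳ ∘ (s′ ⊗₁ id) ∎

  RightResplit⊗⊙ : Hom k A (X ⊗ R) → Hom k R (Y ⊙ Z) → Hom k A (L ⊙ Z) → Hom k L (X ⊗ Y) → Set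
  RightResplit⊗⊙ s t s′ t′ = δˡ ∘ (id ⊗₁ t) ∘ s ≈ (t′ ⊙₁ id) ∘ s′

  resplitʳ⊗⊙-here : RightResplit⊗⊙ (id {A = X ⊗ R}) t (δˡ ∘ (id ⊗₁ t)) id
  resplitʳ⊗⊙-here = ≈-trans (refl⟩∘⟨ idʳ) (≈-sym Par.id⊛id∘)

  resplitʳ⊗⊙-⊗ʳ : RightResplit⊗⊙ s t s′ t′ →
                  RightResplit⊗⊙ (α ∘ (id {A = W} ⊗₁ s)) t (δˡ ∘ (id ⊗₁ s′)) (α ∘ (id ⊗₁ t′))
  resplitʳ⊗⊙-⊗ʳ {s = s} {t = t} {s′ = s′} {t′ = t′} e = begin
    δˡ ∘ (id ⊗₁ t) ∘ α ∘ (id ⊗₁ s)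
      ≈⟨ refl⟩∘⟨ ⊗-cong ⊗-id ≈-refl ⟩∘⟨refl ⟨
    δˡ ∘ ((id ⊗₁ id) ⊗₁ t) ∘ α ∘ (id ⊗₁ s)
      ≈⟨ refl⟩∘⟨ extendʳ α-nat ⟨
    δˡ ∘ α ∘ (id ⊗₁ (id ⊗₁ t)) ∘ (id ⊗₁ s)
      ≈⟨ pullˡ P2 ⟩
    ((α ⊙₁ id) ∘ δˡ ∘ (id ⊗₁ δˡ)) ∘ (id ⊗₁ (id ⊗₁ t)) ∘ (id ⊗₁ s)
      ≈⟨ ≈-trans assoc (refl⟩∘⟨ assoc) ⟩
    (α ⊙₁ id) ∘ δˡ ∘ (id ⊗₁ δˡ) ∘ (id ⊗₁ (id ⊗₁ t)) ∘ (id ⊗₁ s)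
      ≈⟨ refl⟩∘⟨ refl⟩∘⟨ Tensor.splitʳ³ ⟨
    (α ⊙₁ id) ∘ δˡ ∘ (id ⊗₁ (δˡ ∘ (id ⊗₁ t) ∘ s))
      ≈⟨ refl⟩∘⟨ refl⟩∘⟨ ⊗-cong ≈-refl e ⟩
    (α ⊙₁ id) ∘ δˡ ∘ (id ⊗₁ ((t′ ⊙₁ id) ∘ s′))
      ≈⟨ refl⟩∘⟨ refl⟩∘⟨ Tensor.splitʳ ⟩
    (α ⊙₁ id) ∘ δˡ ∘ (id ⊗₁ (t′ ⊙₁ id)) ∘ (id ⊗₁ s′)
      ≈⟨ refl⟩∘⟨ extendʳ δˡ-nat ⟩
    (α ⊙₁ id) ∘ ((id ⊗₁ t′) ⊙₁ id) ∘ δˡ ∘ (id ⊗₁ s′)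
      ≈⟨ pullˡ (≈-sym Par.splitˡ) ⟩
    ((α ∘ (id ⊗₁ t′)) ⊙₁ id) ∘ δˡ ∘ (id ⊗₁ s′) ∎

  resplitʳ⊗⊙-⊗ˡ-⊗ˡ : RightResplit⊗⊙ s t s′ t′ →
                     RightResplit⊗⊙ (α⁻¹ ∘ (s ⊗₁ id {A = W})) (δʳ ∘ (t ⊗₁ id)) (δʳ ∘ (s′ ⊗₁ id)) t′
  resplitʳ⊗⊙-⊗ˡ-⊗ˡ {s = s} {t = t} {s′ = s′} {t′ = t′} e = begin
    δˡ ∘ (id ⊗₁ (δʳ ∘ (t ⊗₁ id))) ∘ α⁻¹ ∘ (s ⊗₁ id)
      ≈⟨ refl⟩∘⟨ Tensor.splitʳ ⟩∘⟨refl ⟩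
    δˡ ∘ ((id ⊗₁ δʳ) ∘ (id ⊗₁ (t ⊗₁ id))) ∘ α⁻¹ ∘ (s ⊗₁ id)
      ≈⟨ refl⟩∘⟨ assoc ⟩
    δˡ ∘ (id ⊗₁ δʳ) ∘ (id ⊗₁ (t ⊗₁ id)) ∘ α⁻¹ ∘ (s ⊗₁ id)
      ≈⟨ refl⟩∘⟨ refl⟩∘⟨ extendʳ TensorIso.b-natural ⟨
    δˡ ∘ (id ⊗₁ δʳ) ∘ α⁻¹ ∘ ((id ⊗₁ t) ⊗₁ id) ∘ (s ⊗₁ id)
      ≈⟨ pull³ P3⁻¹ ⟩
    (δʳ ∘ (δˡ ⊗₁ id)) ∘ ((id ⊗₁ t) ⊗₁ id) ∘ (s ⊗₁ id)
      ≈⟨ assoc ⟩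
    δʳ ∘ (δˡ ⊗₁ id) ∘ ((id ⊗₁ t) ⊗₁ id) ∘ (s ⊗₁ id)
      ≈⟨ refl⟩∘⟨ Tensor.splitˡ³ ⟨
    δʳ ∘ ((δˡ ∘ (id ⊗₁ t) ∘ s) ⊗₁ id)
      ≈⟨ refl⟩∘⟨ ⊗-cong e ≈-refl ⟩
    δʳ ∘ (((t′ ⊙₁ id) ∘ s′) ⊗₁ id)
      ≈⟨ refl⟩∘⟨ Tensor.splitˡ ⟩
    δʳ ∘ ((t′ ⊙₁ id) ⊗₁ id) ∘ (s′ ⊗₁ id)
      ≈⟨ extendʳ δʳ-nat ⟩
    (t′ ⊙₁ (id ⊗₁ id)) ∘ δʳ ∘ (s′ ⊗₁ id)
      ≈⟨ ⊙-cong ≈-refl ⊗-id ⟩∘⟨refl ⟩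
    (t′ ⊙₁ id) ∘ δʳ ∘ (s′ ⊗₁ id) ∎

  resplitʳ⊗⊙-⊗ˡ-⊗ʳ : RightResplit⊗⊙ (α⁻¹ ∘ (s ⊗₁ id)) (δˡ ∘ (id ⊗₁ t)) (δˡ ∘ (id ⊗₁ t)) (α⁻¹ ∘ (s ⊗₁ id))
  resplitʳ⊗⊙-⊗ˡ-⊗ʳ {s = s} {t = t} = begin
    δˡ ∘ (id ⊗₁ (δˡ ∘ (id ⊗₁ t))) ∘ α⁻¹ ∘ (s ⊗₁ id)
      ≈⟨ refl⟩∘⟨ Tensor.splitʳ ⟩∘⟨refl ⟩
    δˡ ∘ ((id ⊗₁ δˡ) ∘ (id ⊗₁ (id ⊗₁ t))) ∘ α⁻¹ ∘ (s ⊗₁ id)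
      ≈⟨ refl⟩∘⟨ assoc ⟩
    δˡ ∘ (id ⊗₁ δˡ) ∘ (id ⊗₁ (id ⊗₁ t)) ∘ α⁻¹ ∘ (s ⊗₁ id)
      ≈⟨ refl⟩∘⟨ refl⟩∘⟨ extendʳ TensorIso.b-natural ⟨
    δˡ ∘ (id ⊗₁ δˡ) ∘ α⁻¹ ∘ ((id ⊗₁ id) ⊗₁ t) ∘ (s ⊗₁ id)
      ≈⟨ refl⟩∘⟨ refl⟩∘⟨ refl⟩∘⟨ Tensor.second∘first ⊗-id ⟩
    δˡ ∘ (id ⊗₁ δˡ) ∘ α⁻¹ ∘ (s ⊗₁ t)
      ≈⟨ pull³ P2⁻¹ ⟩
    ((α⁻¹ ⊙₁ id) ∘ δˡ) ∘ (s ⊗₁ t)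
      ≈⟨ assoc ⟩
    (α⁻¹ ⊙₁ id) ∘ δˡ ∘ (s ⊗₁ t)
      ≈⟨ refl⟩∘⟨ refl⟩∘⟨ Tensor.first∘second ⊙-id ⟨
    (α⁻¹ ⊙₁ id) ∘ δˡ ∘ (s ⊗₁ (id ⊙₁ id)) ∘ (id ⊗₁ t)
      ≈⟨ refl⟩∘⟨ extendʳ δˡ-nat ⟩
    (α⁻¹ ⊙₁ id) ∘ ((s ⊗₁ id) ⊙₁ id) ∘ δˡ ∘ (id ⊗₁ t)
      ≈⟨ pullˡ (≈-sym Par.splitˡ) ⟩
    ((α⁻¹ ∘ (s ⊗₁ id)) ⊙₁ id) ∘ δˡ ∘ (id ⊗₁ t) ∎

  resplitʳ⊙-⊗ˡ-⊗ˡ : ParAssoc.RightResplit s t s′ t′ →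
                    ParAssoc.RightResplit (δʳ ∘ (s ⊗₁ id {A = W})) (δʳ ∘ (t ⊗₁ id)) (δʳ ∘ (s′ ⊗₁ id)) t′
  resplitʳ⊙-⊗ˡ-⊗ˡ {s = s} {t = t} {s′ = s′} {t′ = t′} e = begin
    ᾱ ∘ (id ⊙₁ (δʳ ∘ (t ⊗₁ id))) ∘ δʳ ∘ (s ⊗₁ id)
      ≈⟨ refl⟩∘⟨ Par.splitʳ ⟩∘⟨refl ⟩
    ᾱ ∘ ((id ⊙₁ δʳ) ∘ (id ⊙₁ (t ⊗₁ id))) ∘ δʳ ∘ (s ⊗₁ id)
      ≈⟨ refl⟩∘⟨ assoc ⟩
    ᾱ ∘ (id ⊙₁ δʳ) ∘ (id ⊙₁ (t ⊗₁ id)) ∘ δʳ ∘ (s ⊗₁ id)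
      ≈⟨ refl⟩∘⟨ refl⟩∘⟨ extendʳ δʳ-nat ⟨
    ᾱ ∘ (id ⊙₁ δʳ) ∘ δʳ ∘ ((id ⊙₁ t) ⊗₁ id) ∘ (s ⊗₁ id)
      ≈⟨ pull³ (≈-sym P7) ⟩
    (δʳ ∘ (ᾱ ⊗₁ id)) ∘ ((id ⊙₁ t) ⊗₁ id) ∘ (s ⊗₁ id)
      ≈⟨ assoc ⟩
    δʳ ∘ (ᾱ ⊗₁ id) ∘ ((id ⊙₁ t) ⊗₁ id) ∘ (s ⊗₁ id)
      ≈⟨ refl⟩∘⟨ Tensor.splitˡ³ ⟨
    δʳ ∘ ((ᾱ ∘ (id ⊙₁ t) ∘ s) ⊗₁ id)
      ≈⟨ refl⟩∘⟨ ⊗-cong e ≈-refl ⟩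
    δʳ ∘ (((t′ ⊙₁ id) ∘ s′) ⊗₁ id)
      ≈⟨ refl⟩∘⟨ Tensor.splitˡ ⟩
    δʳ ∘ ((t′ ⊙₁ id) ⊗₁ id) ∘ (s′ ⊗₁ id)
      ≈⟨ extendʳ δʳ-nat ⟩
    (t′ ⊙₁ (id ⊗₁ id)) ∘ δʳ ∘ (s′ ⊗₁ id)
      ≈⟨ ⊙-cong ≈-refl ⊗-id ⟩∘⟨refl ⟩
    (t′ ⊙₁ id) ∘ δʳ ∘ (s′ ⊗₁ id) ∎

  resplitʳ⊙-⊗ˡ-⊗ʳ : ParAssoc.RightResplit (δʳ ∘ (s ⊗₁ id)) (δˡ ∘ (id ⊗₁ t)) (δˡ ∘ (id ⊗₁ t)) (δʳ ∘ (s ⊗₁ id))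
  resplitʳ⊙-⊗ˡ-⊗ʳ {s = s} {t = t} = begin
    ᾱ ∘ (id ⊙₁ (δˡ ∘ (id ⊗₁ t))) ∘ δʳ ∘ (s ⊗₁ id)
      ≈⟨ refl⟩∘⟨ Par.splitʳ ⟩∘⟨refl ⟩
    ᾱ ∘ ((id ⊙₁ δˡ) ∘ (id ⊙₁ (id ⊗₁ t))) ∘ δʳ ∘ (s ⊗₁ id)
      ≈⟨ refl⟩∘⟨ assoc ⟩
    ᾱ ∘ (id ⊙₁ δˡ) ∘ (id ⊙₁ (id ⊗₁ t)) ∘ δʳ ∘ (s ⊗₁ id)
      ≈⟨ refl⟩∘⟨ refl⟩∘⟨ extendʳ δʳ-nat ⟨
    ᾱ ∘ (id ⊙₁ δˡ) ∘ δʳ ∘ ((id ⊙₁ id) ⊗₁ t) ∘ (s ⊗₁ id)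
      ≈⟨ refl⟩∘⟨ refl⟩∘⟨ refl⟩∘⟨ Tensor.second∘first ⊙-id ⟩
    ᾱ ∘ (id ⊙₁ δˡ) ∘ δʳ ∘ (s ⊗₁ t)
      ≈⟨ pull³ (≈-sym P6) ⟩
    ((δʳ ⊙₁ id) ∘ δˡ) ∘ (s ⊗₁ t)
      ≈⟨ assoc ⟩
    (δʳ ⊙₁ id) ∘ δˡ ∘ (s ⊗₁ t)
      ≈⟨ refl⟩∘⟨ refl⟩∘⟨ Tensor.first∘second ⊙-id ⟨
    (δʳ ⊙₁ id) ∘ δˡ ∘ (s ⊗₁ (id ⊙₁ id)) ∘ (id ⊗₁ t)
      ≈⟨ refl⟩∘⟨ extendʳ δˡ-nat ⟩
    (δʳ ⊙₁ id) ∘ ((s ⊗₁ id) ⊙₁ id) ∘ δˡ ∘ (id ⊗₁ t)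
      ≈⟨ pullˡ (≈-sym Par.splitˡ) ⟩
    ((δʳ ∘ (s ⊗₁ id)) ⊙₁ id) ∘ δˡ ∘ (id ⊗₁ t) ∎

  resplitʳ⊙-⊗ʳ : ParAssoc.RightResplit s t s′ t′ →
                 ParAssoc.RightResplit (δˡ ∘ (id {A = W} ⊗₁ s)) t (δˡ ∘ (id ⊗₁ s′)) (δˡ ∘ (id ⊗₁ t′))
  resplitʳ⊙-⊗ʳ {s = s} {t = t} {s′ = s′} {t′ = t′} e = begin
    ᾱ ∘ (id ⊙₁ t) ∘ δˡ ∘ (id ⊗₁ s)
      ≈⟨ refl⟩∘⟨ ⊙-cong ⊗-id ≈-refl ⟩∘⟨refl ⟨
    ᾱ ∘ ((id ⊗₁ id) ⊙₁ t) ∘ δˡ ∘ (id ⊗₁ s)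
      ≈⟨ refl⟩∘⟨ extendʳ δˡ-nat ⟨
    ᾱ ∘ δˡ ∘ (id ⊗₁ (id ⊙₁ t)) ∘ (id ⊗₁ s)
      ≈⟨ pullˡ P4 ⟩
    ((δˡ ⊙₁ id) ∘ δˡ ∘ (id ⊗₁ ᾱ)) ∘ (id ⊗₁ (id ⊙₁ t)) ∘ (id ⊗₁ s)
      ≈⟨ ≈-trans assoc (refl⟩∘⟨ assoc) ⟩
    (δˡ ⊙₁ id) ∘ δˡ ∘ (id ⊗₁ ᾱ) ∘ (id ⊗₁ (id ⊙₁ t)) ∘ (id ⊗₁ s)
      ≈⟨ refl⟩∘⟨ refl⟩∘⟨ Tensor.splitʳ³ ⟨
    (δˡ ⊙₁ id) ∘ δˡ ∘ (id ⊗₁ (ᾱ ∘ (id ⊙₁ t) ∘ s))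
      ≈⟨ refl⟩∘⟨ refl⟩∘⟨ ⊗-cong ≈-refl e ⟩
    (δˡ ⊙₁ id) ∘ δˡ ∘ (id ⊗₁ ((t′ ⊙₁ id) ∘ s′))
      ≈⟨ refl⟩∘⟨ refl⟩∘⟨ Tensor.splitʳ ⟩
    (δˡ ⊙₁ id) ∘ δˡ ∘ (id ⊗₁ (t′ ⊙₁ id)) ∘ (id ⊗₁ s′)
      ≈⟨ refl⟩∘⟨ extendʳ δˡ-nat ⟩
    (δˡ ⊙₁ id) ∘ ((id ⊗₁ t′) ⊙₁ id) ∘ δˡ ∘ (id ⊗₁ s′)
      ≈⟨ pullˡ (≈-sym Par.splitˡ) ⟩
    ((δˡ ∘ (id ⊗₁ t′)) ⊙₁ id) ∘ δˡ ∘ (id ⊗₁ s′) ∎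

  resplitˡ⊙-⊗ˡ : ParIso.LeftResplit s t s′ t′ →
                 ParIso.LeftResplit (δʳ ∘ (s ⊗₁ id {A = W})) t (δʳ ∘ (s′ ⊗₁ id)) (δʳ ∘ (t′ ⊗₁ id))
  resplitˡ⊙-⊗ˡ {s = s} {t = t} {s′ = s′} {t′ = t′} e = begin
    ᾱ⁻¹ ∘ (t ⊙₁ id) ∘ δʳ ∘ (s ⊗₁ id)
      ≈⟨ refl⟩∘⟨ ⊙-cong ≈-refl ⊗-id ⟩∘⟨refl ⟨
    ᾱ⁻¹ ∘ (t ⊙₁ (id ⊗₁ id)) ∘ δʳ ∘ (s ⊗₁ id)
      ≈⟨ refl⟩∘⟨ extendʳ δʳ-nat ⟨
    ᾱ⁻¹ ∘ δʳ ∘ ((t ⊙₁ id) ⊗₁ id) ∘ (s ⊗₁ id)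
      ≈⟨ refl⟩∘⟨ refl⟩∘⟨ Tensor.splitˡ ⟨
    ᾱ⁻¹ ∘ δʳ ∘ (((t ⊙₁ id) ∘ s) ⊗₁ id)
      ≈⟨ pullˡ P7⁻¹ ⟩
    ((id ⊙₁ δʳ) ∘ δʳ ∘ (ᾱ⁻¹ ⊗₁ id)) ∘ (((t ⊙₁ id) ∘ s) ⊗₁ id)
      ≈⟨ ≈-trans assoc (refl⟩∘⟨ assoc) ⟩
    (id ⊙₁ δʳ) ∘ δʳ ∘ (ᾱ⁻¹ ⊗₁ id) ∘ (((t ⊙₁ id) ∘ s) ⊗₁ id)
      ≈⟨ refl⟩∘⟨ refl⟩∘⟨ Tensor.splitˡ ⟨
    (id ⊙₁ δʳ) ∘ δʳ ∘ ((ᾱ⁻¹ ∘ (t ⊙₁ id) ∘ s) ⊗₁ id)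
      ≈⟨ refl⟩∘⟨ refl⟩∘⟨ ⊗-cong e ≈-refl ⟩
    (id ⊙₁ δʳ) ∘ δʳ ∘ (((id ⊙₁ t′) ∘ s′) ⊗₁ id)
      ≈⟨ refl⟩∘⟨ refl⟩∘⟨ Tensor.splitˡ ⟩
    (id ⊙₁ δʳ) ∘ δʳ ∘ ((id ⊙₁ t′) ⊗₁ id) ∘ (s′ ⊗₁ id)
      ≈⟨ refl⟩∘⟨ extendʳ δʳ-nat ⟩
    (id ⊙₁ δʳ) ∘ (id ⊙₁ (t′ ⊗₁ id)) ∘ δʳ ∘ (s′ ⊗₁ id)
      ≈⟨ pullˡ (≈-sym Par.splitʳ) ⟩
    (id ⊙₁ (δʳ ∘ (t′ ⊗₁ id))) ∘ δʳ ∘ (s′ ⊗₁ id) ∎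

  resplitˡ⊙-⊗ʳ-⊗ˡ : ParIso.LeftResplit (δˡ ∘ (id ⊗₁ s)) (δʳ ∘ (t ⊗₁ id)) (δʳ ∘ (t ⊗₁ id)) (δˡ ∘ (id ⊗₁ s))
  resplitˡ⊙-⊗ʳ-⊗ˡ {s = s} {t = t} = begin
    ᾱ⁻¹ ∘ ((δʳ ∘ (t ⊗₁ id)) ⊙₁ id) ∘ δˡ ∘ (id ⊗₁ s)
      ≈⟨ refl⟩∘⟨ Par.splitˡ ⟩∘⟨refl ⟩
    ᾱ⁻¹ ∘ ((δʳ ⊙₁ id) ∘ ((t ⊗₁ id) ⊙₁ id)) ∘ δˡ ∘ (id ⊗₁ s)
      ≈⟨ refl⟩∘⟨ assoc ⟩
    ᾱ⁻¹ ∘ (δʳ ⊙₁ id) ∘ ((t ⊗₁ id) ⊙₁ id) ∘ δˡ ∘ (id ⊗₁ s)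
      ≈⟨ refl⟩∘⟨ refl⟩∘⟨ extendʳ δˡ-nat ⟨
    ᾱ⁻¹ ∘ (δʳ ⊙₁ id) ∘ δˡ ∘ (t ⊗₁ (id ⊙₁ id)) ∘ (id ⊗₁ s)
      ≈⟨ refl⟩∘⟨ refl⟩∘⟨ refl⟩∘⟨ Tensor.first∘second ⊙-id ⟩
    ᾱ⁻¹ ∘ (δʳ ⊙₁ id) ∘ δˡ ∘ (t ⊗₁ s)
      ≈⟨ pull³ P6⁻¹ ⟩
    ((id ⊙₁ δˡ) ∘ δʳ) ∘ (t ⊗₁ s)
      ≈⟨ assoc ⟩
    (id ⊙₁ δˡ) ∘ δʳ ∘ (t ⊗₁ s)
      ≈⟨ refl⟩∘⟨ refl⟩∘⟨ Tensor.second∘first ⊙-id ⟨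
    (id ⊙₁ δˡ) ∘ δʳ ∘ ((id ⊙₁ id) ⊗₁ s) ∘ (t ⊗₁ id)
      ≈⟨ refl⟩∘⟨ extendʳ δʳ-nat ⟩
    (id ⊙₁ δˡ) ∘ (id ⊙₁ (id ⊗₁ s)) ∘ δʳ ∘ (t ⊗₁ id)
      ≈⟨ pullˡ (≈-sym Par.splitʳ) ⟩
    (id ⊙₁ (δˡ ∘ (id ⊗₁ s))) ∘ δʳ ∘ (t ⊗₁ id) ∎

  resplitˡ⊙-⊗ʳ-⊗ʳ : ParIso.LeftResplit s t s′ t′ →
                    ParIso.LeftResplit (δˡ ∘ (id {A = W} ⊗₁ s)) (δˡ ∘ (id ⊗₁ t)) (δˡ ∘ (id ⊗₁ s′)) t′
  resplitˡ⊙-⊗ʳ-⊗ʳ {s = s} {t = t} {s′ = s′} {t′ = t′} e = begin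
    ᾱ⁻¹ ∘ ((δˡ ∘ (id ⊗₁ t)) ⊙₁ id) ∘ δˡ ∘ (id ⊗₁ s)
      ≈⟨ refl⟩∘⟨ Par.splitˡ ⟩∘⟨refl ⟩
    ᾱ⁻¹ ∘ ((δˡ ⊙₁ id) ∘ ((id ⊗₁ t) ⊙₁ id)) ∘ δˡ ∘ (id ⊗₁ s)
      ≈⟨ refl⟩∘⟨ assoc ⟩
    ᾱ⁻¹ ∘ (δˡ ⊙₁ id) ∘ ((id ⊗₁ t) ⊙₁ id) ∘ δˡ ∘ (id ⊗₁ s)
      ≈⟨ refl⟩∘⟨ refl⟩∘⟨ extendʳ δˡ-nat ⟨
    ᾱ⁻¹ ∘ (δˡ ⊙₁ id) ∘ δˡ ∘ (id ⊗₁ (t ⊙₁ id)) ∘ (id ⊗₁ s)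
      ≈⟨ pull³ P4⁻¹ ⟩
    (δˡ ∘ (id ⊗₁ ᾱ⁻¹)) ∘ (id ⊗₁ (t ⊙₁ id)) ∘ (id ⊗₁ s)
      ≈⟨ assoc ⟩
    δˡ ∘ (id ⊗₁ ᾱ⁻¹) ∘ (id ⊗₁ (t ⊙₁ id)) ∘ (id ⊗₁ s)
      ≈⟨ refl⟩∘⟨ Tensor.splitʳ³ ⟨
    δˡ ∘ (id ⊗₁ (ᾱ⁻¹ ∘ (t ⊙₁ id) ∘ s))
      ≈⟨ refl⟩∘⟨ ⊗-cong ≈-refl e ⟩
    δˡ ∘ (id ⊗₁ ((id ⊙₁ t′) ∘ s′))
      ≈⟨ refl⟩∘⟨ Tensor.splitʳ ⟩
    δˡ ∘ (id ⊗₁ (id ⊙₁ t′)) ∘ (id ⊗₁ s′)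
      ≈⟨ extendʳ δˡ-nat ⟩
    ((id ⊗₁ id) ⊙₁ t′) ∘ δˡ ∘ (id ⊗₁ s′)
      ≈⟨ ⊙-cong ⊗-id ≈-refl ⟩∘⟨refl ⟩
    (id ⊙₁ t′) ∘ δˡ ∘ (id ⊗₁ s′) ∎

  pull-⊗ˡ⊙ : t ∘ h₁ ≈ (w₁ ⊙₁ w₂) ∘ r → LeftResplit⊗⊙ s r s′ t′ →
             (δʳ ∘ (t ⊗₁ id)) ∘ (h₁ ⊗₁ h₂) ∘ s ≈ (w₁ ⊙₁ ((w₂ ⊗₁ h₂) ∘ t′)) ∘ s′
  pull-⊗ˡ⊙ {t = t} {h₁ = h₁} {w₁ = w₁} {w₂ = w₂} {r = r} {s = s} {s′ = s′} {t′ = t′} {h₂ = h₂}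
           t-natural e = begin
    (δʳ ∘ (t ⊗₁ id)) ∘ (h₁ ⊗₁ h₂) ∘ s
      ≈⟨ assoc ⟩
    δʳ ∘ (t ⊗₁ id) ∘ (h₁ ⊗₁ h₂) ∘ s
      ≈⟨ refl⟩∘⟨ pullˡ (≈-trans Tensor.merge (⊗-cong t-natural idˡ)) ⟩
    δʳ ∘ (((w₁ ⊙₁ w₂) ∘ r) ⊗₁ h₂) ∘ s
      ≈⟨ refl⟩∘⟨ Tensor.absorbˡ ⟩∘⟨refl ⟨
    δʳ ∘ (((w₁ ⊙₁ w₂) ⊗₁ h₂) ∘ (r ⊗₁ id)) ∘ s
      ≈⟨ refl⟩∘⟨ assoc ⟩
    δʳ ∘ ((w₁ ⊙₁ w₂) ⊗₁ h₂) ∘ (r ⊗₁ id) ∘ s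
      ≈⟨ extendʳ δʳ-nat ⟩
    (w₁ ⊙₁ (w₂ ⊗₁ h₂)) ∘ δʳ ∘ (r ⊗₁ id) ∘ s
      ≈⟨ refl⟩∘⟨ e ⟩
    (w₁ ⊙₁ (w₂ ⊗₁ h₂)) ∘ (id ⊙₁ t′) ∘ s′
      ≈⟨ pullˡ Par.absorbʳ ⟩
    (w₁ ⊙₁ ((w₂ ⊗₁ h₂) ∘ t′)) ∘ s′ ∎

  pull-⊗ʳ⊙ : t ∘ h₂ ≈ (w₁ ⊙₁ w₂) ∘ r → RightResplit⊗⊙ s r s′ t′ →
             (δˡ ∘ (id ⊗₁ t)) ∘ (h₁ ⊗₁ h₂) ∘ s ≈ (((h₁ ⊗₁ w₁) ∘ t′) ⊙₁ w₂) ∘ s′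
  pull-⊗ʳ⊙ {t = t} {h₂ = h₂} {w₁ = w₁} {w₂ = w₂} {r = r} {s = s} {s′ = s′} {t′ = t′} {h₁ = h₁}
           t-natural e = begin
    (δˡ ∘ (id ⊗₁ t)) ∘ (h₁ ⊗₁ h₂) ∘ s
      ≈⟨ assoc ⟩
    δˡ ∘ (id ⊗₁ t) ∘ (h₁ ⊗₁ h₂) ∘ s
      ≈⟨ refl⟩∘⟨ pullˡ (≈-trans Tensor.merge (⊗-cong idˡ t-natural)) ⟩
    δˡ ∘ (h₁ ⊗₁ ((w₁ ⊙₁ w₂) ∘ r)) ∘ s
      ≈⟨ refl⟩∘⟨ Tensor.absorbʳ ⟩∘⟨refl ⟨
    δˡ ∘ ((h₁ ⊗₁ (w₁ ⊙₁ w₂)) ∘ (id ⊗₁ r)) ∘ s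
      ≈⟨ refl⟩∘⟨ assoc ⟩
    δˡ ∘ (h₁ ⊗₁ (w₁ ⊙₁ w₂)) ∘ (id ⊗₁ r) ∘ s
      ≈⟨ extendʳ δˡ-nat ⟩
    ((h₁ ⊗₁ w₁) ⊙₁ w₂) ∘ δˡ ∘ (id ⊗₁ r) ∘ s
      ≈⟨ refl⟩∘⟨ e ⟩
    ((h₁ ⊗₁ w₁) ⊙₁ w₂) ∘ (t′ ⊙₁ id) ∘ s′
      ≈⟨ pullˡ Par.absorbˡ ⟩
    (((h₁ ⊗₁ w₁) ∘ t′) ⊙₁ w₂) ∘ s′ ∎

  -- Splits and canonical morphisms

  -- A split records the position at which A is cut into L and R.
  data Split⊗ : Kind → Ob S → Ob S → Ob S → Set where
    here : Split⊗ k (L ⊗ R) L R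
    ⊗ʳ   : Split⊗ k B L R → Split⊗ k (A ⊗ B) (A ⊗ L) R
    ⊗ˡ   : Split⊗ strong A L R → Split⊗ strong (A ⊗ B) L (R ⊗ B)

  ⟦_⟧⊗ : Split⊗ k A L R → Hom k A (L ⊗ R)
  ⟦ here ⟧⊗ = id
  ⟦ ⊗ʳ s ⟧⊗ = α ∘ (id ⊗₁ ⟦ s ⟧⊗)
  ⟦ ⊗ˡ s ⟧⊗ = α⁻¹ ∘ (⟦ s ⟧⊗ ⊗₁ id)

  data Split⊙ : Kind → Ob S → Ob S → Ob S → Set where
    here : Split⊙ k (L ⊙ R) L R
    ⊙ʳ   : Split⊙ k B L R → Split⊙ k (A ⊙ B) (A ⊙ L) R
    ⊙ˡ   : Split⊙ strong A L R → Split⊙ strong (A ⊙ B) L (R ⊙ B)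
    ⊗ʳ   : Split⊙ k B L R → Split⊙ k (A ⊗ B) (A ⊗ L) R
    ⊗ˡ   : Split⊙ k A L R → Split⊙ k (A ⊗ B) L (R ⊗ B)

  ⟦_⟧⊙ : Split⊙ k A L R → Hom k A (L ⊙ R)
  ⟦ here ⟧⊙ = id
  ⟦ ⊙ʳ s ⟧⊙ = ᾱ ∘ (id ⊙₁ ⟦ s ⟧⊙)
  ⟦ ⊙ˡ s ⟧⊙ = ᾱ⁻¹ ∘ (⟦ s ⟧⊙ ⊙₁ id)
  ⟦ ⊗ʳ s ⟧⊙ = δˡ ∘ (id ⊗₁ ⟦ s ⟧⊙)
  ⟦ ⊗ˡ s ⟧⊙ = δʳ ∘ (⟦ s ⟧⊙ ⊗₁ id)

  data Canonical (k : Kind) : Ob S → Ob S → Set where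
    var    : (x : S) → Canonical k (var x) (var x)
    _⊗⟨_⟩_ : Canonical k L B → Split⊗ k A L R → Canonical k R C → Canonical k A (B ⊗ C)
    _⊙⟨_⟩_ : Canonical k L B → Split⊙ k A L R → Canonical k R C → Canonical k A (B ⊙ C)

  ⟦_⟧ : Canonical k A B → Hom k A B
  ⟦ var x ⟧ = id
  ⟦ u ⊗⟨ s ⟩ v ⟧ = (⟦ u ⟧ ⊗₁ ⟦ v ⟧) ∘ ⟦ s ⟧⊗
  ⟦ u ⊙⟨ s ⟩ v ⟧ = (⟦ u ⟧ ⊙₁ ⟦ v ⟧) ∘ ⟦ s ⟧⊙

  IsCanonical : Hom k A B → Set
  IsCanonical {k = k} {A = A} {B = B} f = Σ[ u ∈ Canonical k A B ] f ≈ ⟦ u ⟧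

  resplitʳ⊗ : (s : Split⊗ k A X R) (t : Split⊗ k R Y Z) →
              Σ[ L ∈ Ob S ] Σ[ s′ ∈ Split⊗ k A L Z ] Σ[ t′ ∈ Split⊗ k L X Y ]
                TensorAssoc.RightResplit ⟦ s ⟧⊗ ⟦ t ⟧⊗ ⟦ s′ ⟧⊗ ⟦ t′ ⟧⊗
  resplitʳ⊗ here t = _ , ⊗ʳ t , here , TensorAssoc.resplitʳ-here
  resplitʳ⊗ (⊗ʳ s) t with resplitʳ⊗ s t
  ... | _ , s′ , t′ , e = _ , ⊗ʳ s′ , ⊗ʳ t′ , TensorAssoc.resplitʳ-⊛ʳ e
  resplitʳ⊗ (⊗ˡ s) here = _ , here , s , TensorIso.resplitʳ-⊛ˡ-here
  resplitʳ⊗ (⊗ˡ s) (⊗ʳ t) = _ , ⊗ʳ t , ⊗ˡ s , TensorIso.resplitʳ-⊛ˡ-⊛ʳ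
  resplitʳ⊗ (⊗ˡ s) (⊗ˡ t) with resplitʳ⊗ s t
  ... | _ , s′ , t′ , e = _ , ⊗ˡ s′ , t′ , TensorIso.resplitʳ-⊛ˡ-⊛ˡ e

  resplitˡ⊗ : (s : Split⊗ strong A X R) (t : Split⊗ strong X X₁ X₂) →
              Σ[ Q ∈ Ob S ] Σ[ s′ ∈ Split⊗ strong A X₁ Q ] Σ[ t′ ∈ Split⊗ strong Q X₂ R ]
                TensorIso.LeftResplit ⟦ s ⟧⊗ ⟦ t ⟧⊗ ⟦ s′ ⟧⊗ ⟦ t′ ⟧⊗
  resplitˡ⊗ here t = _ , ⊗ˡ t , here , TensorIso.resplitˡ-here
  resplitˡ⊗ (⊗ˡ s) t with resplitˡ⊗ s t
  ... | _ , s′ , t′ , e = _ , ⊗ˡ s′ , ⊗ˡ t′ , TensorIso.resplitˡ-⊛ˡ e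
  resplitˡ⊗ (⊗ʳ s) here = _ , here , s , TensorIso.resplitˡ-⊛ʳ-here
  resplitˡ⊗ (⊗ʳ s) (⊗ʳ t) with resplitˡ⊗ s t
  ... | _ , s′ , t′ , e = _ , ⊗ʳ s′ , t′ , TensorIso.resplitˡ-⊛ʳ-⊛ʳ e
  resplitˡ⊗ (⊗ʳ s) (⊗ˡ t) = _ , ⊗ˡ t , ⊗ʳ s , TensorIso.resplitˡ-⊛ʳ-⊛ˡ

  resplitʳ⊙ : (s : Split⊙ k A X R) (t : Split⊙ k R Y Z) →
              Σ[ L ∈ Ob S ] Σ[ s′ ∈ Split⊙ k A L Z ] Σ[ t′ ∈ Split⊙ k L X Y ]
                ParAssoc.RightResplit ⟦ s ⟧⊙ ⟦ t ⟧⊙ ⟦ s′ ⟧⊙ ⟦ t′ ⟧⊙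
  resplitʳ⊙ here t = _ , ⊙ʳ t , here , ParAssoc.resplitʳ-here
  resplitʳ⊙ (⊙ʳ s) t with resplitʳ⊙ s t
  ... | _ , s′ , t′ , e = _ , ⊙ʳ s′ , ⊙ʳ t′ , ParAssoc.resplitʳ-⊛ʳ e
  resplitʳ⊙ (⊙ˡ s) here = _ , here , s , ParIso.resplitʳ-⊛ˡ-here
  resplitʳ⊙ (⊙ˡ s) (⊙ʳ t) = _ , ⊙ʳ t , ⊙ˡ s , ParIso.resplitʳ-⊛ˡ-⊛ʳ
  resplitʳ⊙ (⊙ˡ s) (⊙ˡ t) with resplitʳ⊙ s t
  ... | _ , s′ , t′ , e = _ , ⊙ˡ s′ , t′ , ParIso.resplitʳ-⊛ˡ-⊛ˡ e
  resplitʳ⊙ (⊗ʳ s) t with resplitʳ⊙ s t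
  ... | _ , s′ , t′ , e = _ , ⊗ʳ s′ , ⊗ʳ t′ , resplitʳ⊙-⊗ʳ e
  resplitʳ⊙ (⊗ˡ s) (⊗ʳ t) = _ , ⊗ʳ t , ⊗ˡ s , resplitʳ⊙-⊗ˡ-⊗ʳ
  resplitʳ⊙ (⊗ˡ s) (⊗ˡ t) with resplitʳ⊙ s t
  ... | _ , s′ , t′ , e = _ , ⊗ˡ s′ , t′ , resplitʳ⊙-⊗ˡ-⊗ˡ e

  resplitˡ⊙ : (s : Split⊙ strong A X R) (t : Split⊙ strong X X₁ X₂) →
              Σ[ Q ∈ Ob S ] Σ[ s′ ∈ Split⊙ strong A X₁ Q ] Σ[ t′ ∈ Split⊙ strong Q X₂ R ]
                ParIso.LeftResplit ⟦ s ⟧⊙ ⟦ t ⟧⊙ ⟦ s′ ⟧⊙ ⟦ t′ ⟧⊙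
  resplitˡ⊙ here t = _ , ⊙ˡ t , here , ParIso.resplitˡ-here
  resplitˡ⊙ (⊙ˡ s) t with resplitˡ⊙ s t
  ... | _ , s′ , t′ , e = _ , ⊙ˡ s′ , ⊙ˡ t′ , ParIso.resplitˡ-⊛ˡ e
  resplitˡ⊙ (⊙ʳ s) here = _ , here , s , ParIso.resplitˡ-⊛ʳ-here
  resplitˡ⊙ (⊙ʳ s) (⊙ʳ t) with resplitˡ⊙ s t
  ... | _ , s′ , t′ , e = _ , ⊙ʳ s′ , t′ , ParIso.resplitˡ-⊛ʳ-⊛ʳ e
  resplitˡ⊙ (⊙ʳ s) (⊙ˡ t) = _ , ⊙ˡ t , ⊙ʳ s , ParIso.resplitˡ-⊛ʳ-⊛ˡ
  resplitˡ⊙ (⊗ˡ s) t with resplitˡ⊙ s t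
  ... | _ , s′ , t′ , e = _ , ⊗ˡ s′ , ⊗ˡ t′ , resplitˡ⊙-⊗ˡ e
  resplitˡ⊙ (⊗ʳ s) (⊗ʳ t) with resplitˡ⊙ s t
  ... | _ , s′ , t′ , e = _ , ⊗ʳ s′ , t′ , resplitˡ⊙-⊗ʳ-⊗ʳ e
  resplitˡ⊙ (⊗ʳ s) (⊗ˡ t) = _ , ⊗ˡ t , ⊗ʳ s , resplitˡ⊙-⊗ʳ-⊗ˡ

  resplitˡ⊗⊙ : (s : Split⊗ k A X R) (t : Split⊙ k X X₁ X₂) →
               Σ[ Q ∈ Ob S ] Σ[ s′ ∈ Split⊙ k A X₁ Q ] Σ[ t′ ∈ Split⊗ k Q X₂ R ]
                 LeftResplit⊗⊙ ⟦ s ⟧⊗ ⟦ t ⟧⊙ ⟦ s′ ⟧⊙ ⟦ t′ ⟧⊗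
  resplitˡ⊗⊙ here t = _ , ⊗ˡ t , here , resplitˡ⊗⊙-here
  resplitˡ⊗⊙ (⊗ʳ s) (⊗ʳ t) with resplitˡ⊗⊙ s t
  ... | _ , s′ , t′ , e = _ , ⊗ʳ s′ , t′ , resplitˡ⊗⊙-⊗ʳ-⊗ʳ e
  resplitˡ⊗⊙ (⊗ʳ s) (⊗ˡ t) = _ , ⊗ˡ t , ⊗ʳ s , resplitˡ⊗⊙-⊗ʳ-⊗ˡ
  resplitˡ⊗⊙ (⊗ˡ s) t with resplitˡ⊗⊙ s t
  ... | _ , s′ , t′ , e = _ , ⊗ˡ s′ , ⊗ˡ t′ , resplitˡ⊗⊙-⊗ˡ e

  resplitʳ⊗⊙ : (s : Split⊗ k A X R) (t : Split⊙ k R Y Z) →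
               Σ[ L ∈ Ob S ] Σ[ s′ ∈ Split⊙ k A L Z ] Σ[ t′ ∈ Split⊗ k L X Y ]
                 RightResplit⊗⊙ ⟦ s ⟧⊗ ⟦ t ⟧⊙ ⟦ s′ ⟧⊙ ⟦ t′ ⟧⊗
  resplitʳ⊗⊙ here t = _ , ⊗ʳ t , here , resplitʳ⊗⊙-here
  resplitʳ⊗⊙ (⊗ʳ s) t with resplitʳ⊗⊙ s t
  ... | _ , s′ , t′ , e = _ , ⊗ʳ s′ , ⊗ʳ t′ , resplitʳ⊗⊙-⊗ʳ e
  resplitʳ⊗⊙ (⊗ˡ s) (⊗ʳ t) = _ , ⊗ʳ t , ⊗ˡ s , resplitʳ⊗⊙-⊗ˡ-⊗ʳ
  resplitʳ⊗⊙ (⊗ˡ s) (⊗ˡ t) with resplitʳ⊗⊙ s t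
  ... | _ , s′ , t′ , e = _ , ⊗ˡ s′ , t′ , resplitʳ⊗⊙-⊗ˡ-⊗ˡ e

  pull⊗ : (w : Canonical k A M) (s : Split⊗ k M L R) → IsCanonical (⟦ s ⟧⊗ ∘ ⟦ w ⟧)
  pull⊗ (u ⊗⟨ s ⟩ v) here = u ⊗⟨ s ⟩ v , idˡ
  pull⊗ (u ⊗⟨ s ⟩ v) (⊗ʳ t) with pull⊗ v t
  ... | v₁ ⊗⟨ r ⟩ v₂ , e with resplitʳ⊗ s r
  ...   | _ , s′ , t′ , e′ = (u ⊗⟨ t′ ⟩ v₁) ⊗⟨ s′ ⟩ v₂ , TensorAssoc.pull-⊛ʳ e e′
  pull⊗ (u ⊗⟨ s ⟩ v) (⊗ˡ t) with pull⊗ u t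
  ... | u₁ ⊗⟨ r ⟩ u₂ , e with resplitˡ⊗ s r
  ...   | _ , s′ , t′ , e′ = u₁ ⊗⟨ s′ ⟩ (u₂ ⊗⟨ t′ ⟩ v) , TensorIso.pull-⊛ˡ e e′

  pull⊙ : (w : Canonical k A M) (s : Split⊙ k M L R) → IsCanonical (⟦ s ⟧⊙ ∘ ⟦ w ⟧)
  pull⊙ (u ⊙⟨ s ⟩ v) here = u ⊙⟨ s ⟩ v , idˡ
  pull⊙ (u ⊙⟨ s ⟩ v) (⊙ʳ t) with pull⊙ v t
  ... | v₁ ⊙⟨ r ⟩ v₂ , e with resplitʳ⊙ s r
  ...   | _ , s′ , t′ , e′ = (u ⊙⟨ t′ ⟩ v₁) ⊙⟨ s′ ⟩ v₂ , ParAssoc.pull-⊛ʳ e e′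
  pull⊙ (u ⊙⟨ s ⟩ v) (⊙ˡ t) with pull⊙ u t
  ... | u₁ ⊙⟨ r ⟩ u₂ , e with resplitˡ⊙ s r
  ...   | _ , s′ , t′ , e′ = u₁ ⊙⟨ s′ ⟩ (u₂ ⊙⟨ t′ ⟩ v) , ParIso.pull-⊛ˡ e e′
  pull⊙ (u ⊗⟨ s ⟩ v) (⊗ʳ t) with pull⊙ v t
  ... | v₁ ⊙⟨ r ⟩ v₂ , e with resplitʳ⊗⊙ s r
  ...   | _ , s′ , t′ , e′ = (u ⊗⟨ t′ ⟩ v₁) ⊙⟨ s′ ⟩ v₂ , pull-⊗ʳ⊙ e e′
  pull⊙ (u ⊗⟨ s ⟩ v) (⊗ˡ t) with pull⊙ u t
  ... | u₁ ⊙⟨ r ⟩ u₂ , e with resplitˡ⊗⊙ s r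
  ...   | _ , s′ , t′ , e′ = u₁ ⊙⟨ s′ ⟩ (u₂ ⊗⟨ t′ ⟩ v) , pull-⊗ˡ⊙ e e′

  canonical-∘ : (v : Canonical k M B) (w : Canonical k A M) → IsCanonical (⟦ v ⟧ ∘ ⟦ w ⟧)
  canonical-∘ (var x) w = w , idˡ
  canonical-∘ (v₁ ⊗⟨ s ⟩ v₂) w with pull⊗ w s
  ... | w₁ ⊗⟨ s′ ⟩ w₂ , e with canonical-∘ v₁ w₁ | canonical-∘ v₂ w₂
  ...   | u₁ , e₁ | u₂ , e₂ = u₁ ⊗⟨ s′ ⟩ u₂ , Tensor.split-compose e₁ e₂ e
  canonical-∘ (v₁ ⊙⟨ s ⟩ v₂) w with pull⊙ w s
  ... | w₁ ⊙⟨ s′ ⟩ w₂ , e with canonical-∘ v₁ w₁ | canonical-∘ v₂ w₂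
  ...   | u₁ , e₁ | u₂ , e₂ = u₁ ⊙⟨ s′ ⟩ u₂ , Par.split-compose e₁ e₂ e

  IsCanonical-resp : f ≈ g → IsCanonical f → IsCanonical g
  IsCanonical-resp f≈g (u , e) = u , ≈-trans (≈-sym f≈g) e

  ⊗-canonical : IsCanonical f → IsCanonical g → (s : Split⊗ k A L R) →
                IsCanonical ((f ⊗₁ g) ∘ ⟦ s ⟧⊗)
  ⊗-canonical (u , e) (v , e′) s = u ⊗⟨ s ⟩ v , ⊗-cong e e′ ⟩∘⟨refl

  ⊙-canonical : IsCanonical f → IsCanonical g → (s : Split⊙ k A L R) →
                IsCanonical ((f ⊙₁ g) ∘ ⟦ s ⟧⊙)
  ⊙-canonical (u , e) (v , e′) s = u ⊙⟨ s ⟩ v , ⊙-cong e e′ ⟩∘⟨refl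

  canonical-id : (A : Ob S) → IsCanonical (id {k = k} {A = A})
  canonical-id (var x) = var x , ≈-refl
  canonical-id (A ⊗ B) =
    IsCanonical-resp (≈-trans idʳ ⊗-id) (⊗-canonical (canonical-id A) (canonical-id B) here)
  canonical-id (A ⊙ B) =
    IsCanonical-resp (≈-trans idʳ ⊙-id) (⊙-canonical (canonical-id A) (canonical-id B) here)

  split⊗-canonical : (s : Split⊗ k A L R) → IsCanonical ⟦ s ⟧⊗
  split⊗-canonical s = IsCanonical-resp Tensor.id⊛id∘ (⊗-canonical (canonical-id _) (canonical-id _) s)

  split⊙-canonical : (s : Split⊙ k A L R) → IsCanonical ⟦ s ⟧⊙
  split⊙-canonical s = IsCanonical-resp Par.id⊛id∘ (⊙-canonical (canonical-id _) (canonical-id _) s)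

  canonical : (f : Hom k A B) → IsCanonical f
  canonical id = canonical-id _
  canonical (f ∘ g) with canonical f | canonical g
  ... | u , e | v , e′ = IsCanonical-resp (≈-sym (e ⟩∘⟨ e′)) (canonical-∘ u v)
  canonical (f ⊗₁ g) = IsCanonical-resp idʳ (⊗-canonical (canonical f) (canonical g) here)
  canonical (f ⊙₁ g) = IsCanonical-resp idʳ (⊙-canonical (canonical f) (canonical g) here)
  canonical α = IsCanonical-resp (≈-trans (refl⟩∘⟨ ⊗-id) idʳ) (split⊗-canonical (⊗ʳ here))
  canonical α⁻¹ = IsCanonical-resp (≈-trans (refl⟩∘⟨ ⊗-id) idʳ) (split⊗-canonical (⊗ˡ here))
  canonical ᾱ = IsCanonical-resp (≈-trans (refl⟩∘⟨ ⊙-id) idʳ) (split⊙-canonical (⊙ʳ here))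
  canonical ᾱ⁻¹ = IsCanonical-resp (≈-trans (refl⟩∘⟨ ⊙-id) idʳ) (split⊙-canonical (⊙ˡ here))
  canonical δˡ = IsCanonical-resp (≈-trans (refl⟩∘⟨ ⊗-id) idʳ) (split⊙-canonical (⊗ʳ here))
  canonical δʳ = IsCanonical-resp (≈-trans (refl⟩∘⟨ ⊗-id) idʳ) (split⊙-canonical (⊗ˡ here))

  -- Uniqueness of canonical morphisms

  size : Ob S → ℕ
  size (var x) = 1
  size (A ⊗ B) = size A + size B
  size (A ⊙ B) = size A + size B

  size-positive : (A : Ob S) → 0 < size A
  size-positive (var x) = z<s
  size-positive (A ⊗ B) = ≤-trans (size-positive A) (m≤m+n (size A) (size B))
  size-positive (A ⊙ B) = ≤-trans (size-positive A) (m≤m+n (size A) (size B))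

  m≢m+size : ∀ m A → m ≢ m + size A
  m≢m+size m A = <⇒≢ (m<m+n m (size-positive A))

  size-split⊗ : Split⊗ k A L R → size A ≡ size L + size R
  size-split⊗ here = refl
  size-split⊗ (⊗ʳ {L = L} {R = R} {A = A} s) =
    trans (cong (size A +_) (size-split⊗ s)) (sym (+-assoc (size A) (size L) (size R)))
  size-split⊗ (⊗ˡ {L = L} {R = R} {B = B} s) =
    trans (cong (_+ size B) (size-split⊗ s)) (+-assoc (size L) (size R) (size B))

  size-split⊙ : Split⊙ k A L R → size A ≡ size L + size R
  size-split⊙ here = refl
  size-split⊙ (⊙ʳ {L = L} {R = R} {A = A} s) =
    trans (cong (size A +_) (size-split⊙ s)) (sym (+-assoc (size A) (size L) (size R)))
  size-split⊙ (⊙ˡ {L = L} {R = R} {B = B} s) =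
    trans (cong (_+ size B) (size-split⊙ s)) (+-assoc (size L) (size R) (size B))
  size-split⊙ (⊗ʳ {L = L} {R = R} {A = A} s) =
    trans (cong (size A +_) (size-split⊙ s)) (sym (+-assoc (size A) (size L) (size R)))
  size-split⊙ (⊗ˡ {L = L} {R = R} {B = B} s) =
    trans (cong (_+ size B) (size-split⊙ s)) (+-assoc (size L) (size R) (size B))

  size-canonical : Canonical k A B → size A ≡ size B
  size-canonical (var x) = refl
  size-canonical (u ⊗⟨ s ⟩ v) = trans (size-split⊗ s) (cong₂ _+_ (size-canonical u) (size-canonical v))
  size-canonical (u ⊙⟨ s ⟩ v) = trans (size-split⊙ s) (cong₂ _+_ (size-canonical u) (size-canonical v))

  left-smaller⊗ : Split⊗ k A L R → size L < size A
  left-smaller⊗ {L = L} {R = R} s = subst (size L <_) (sym (size-split⊗ s)) (m<m+n (size L) (size-positive R))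

  left-smaller⊙ : Split⊙ k A L R → size L < size A
  left-smaller⊙ {L = L} {R = R} s = subst (size L <_) (sym (size-split⊙ s)) (m<m+n (size L) (size-positive R))

  m+n≡o⇒o≮m : ∀ m n {o} → m + n ≡ o → o ≮ m
  m+n≡o⇒o≮m m n e o<m = m+n≮m m n (subst (_< m) (sym e) o<m)

  split⊗-unique : (s : Split⊗ k A L R) (s′ : Split⊗ k A L′ R′) → size L ≡ size L′ →
                  _≡_ {A = ∃₂ (Split⊗ k A)} (L , R , s) (L′ , R′ , s′)
  split⊗-unique here here e = refl
  split⊗-unique here (⊗ʳ {L = L} s′) e = ⊥-elim (m≢m+size _ L e)
  split⊗-unique here (⊗ˡ s′) e = ⊥-elim (<⇒≢ (left-smaller⊗ s′) (sym e))
  split⊗-unique (⊗ʳ {L = L} s) here e = ⊥-elim (m≢m+size _ L (sym e))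
  split⊗-unique (⊗ʳ s) (⊗ʳ s′) e with split⊗-unique s s′ (+-cancelˡ-≡ _ _ _ e)
  ... | refl = refl
  split⊗-unique (⊗ʳ {L = L} {A = A} s) (⊗ˡ s′) e =
    ⊥-elim (m+n≡o⇒o≮m (size A) (size L) e (left-smaller⊗ s′))
  split⊗-unique (⊗ˡ s) here e = ⊥-elim (<⇒≢ (left-smaller⊗ s) e)
  split⊗-unique (⊗ˡ s) (⊗ʳ {L = L} {A = A} s′) e =
    ⊥-elim (m+n≡o⇒o≮m (size A) (size L) (sym e) (left-smaller⊗ s))
  split⊗-unique (⊗ˡ s) (⊗ˡ s′) e with split⊗-unique s s′ e
  ... | refl = refl

  split⊙-unique : (s : Split⊙ k A L R) (s′ : Split⊙ k A L′ R′) → size L ≡ size L′ →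
                  _≡_ {A = ∃₂ (Split⊙ k A)} (L , R , s) (L′ , R′ , s′)
  split⊙-unique here here e = refl
  split⊙-unique here (⊙ʳ {L = L} s′) e = ⊥-elim (m≢m+size _ L e)
  split⊙-unique here (⊙ˡ s′) e = ⊥-elim (<⇒≢ (left-smaller⊙ s′) (sym e))
  split⊙-unique (⊙ʳ {L = L} s) here e = ⊥-elim (m≢m+size _ L (sym e))
  split⊙-unique (⊙ʳ s) (⊙ʳ s′) e with split⊙-unique s s′ (+-cancelˡ-≡ _ _ _ e)
  ... | refl = refl
  split⊙-unique (⊙ʳ {L = L} {A = A} s) (⊙ˡ s′) e =
    ⊥-elim (m+n≡o⇒o≮m (size A) (size L) e (left-smaller⊙ s′))
  split⊙-unique (⊙ˡ s) here e = ⊥-elim (<⇒≢ (left-smaller⊙ s) e)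
  split⊙-unique (⊙ˡ s) (⊙ʳ {L = L} {A = A} s′) e =
    ⊥-elim (m+n≡o⇒o≮m (size A) (size L) (sym e) (left-smaller⊙ s))
  split⊙-unique (⊙ˡ s) (⊙ˡ s′) e with split⊙-unique s s′ e
  ... | refl = refl
  split⊙-unique (⊗ʳ s) (⊗ʳ s′) e with split⊙-unique s s′ (+-cancelˡ-≡ _ _ _ e)
  ... | refl = refl
  split⊙-unique (⊗ʳ {L = L} {A = A} s) (⊗ˡ s′) e =
    ⊥-elim (m+n≡o⇒o≮m (size A) (size L) e (left-smaller⊙ s′))
  split⊙-unique (⊗ˡ s) (⊗ʳ {L = L} {A = A} s′) e =
    ⊥-elim (m+n≡o⇒o≮m (size A) (size L) (sym e) (left-smaller⊙ s))
  split⊙-unique (⊗ˡ s) (⊗ˡ s′) e with split⊙-unique s s′ e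
  ... | refl = refl

  canonical-unique : (u v : Canonical k A B) → ⟦ u ⟧ ≈ ⟦ v ⟧
  canonical-unique (var x) (var _) = ≈-refl
  canonical-unique (u₁ ⊗⟨ s ⟩ u₂) (v₁ ⊗⟨ s′ ⟩ v₂)
    with split⊗-unique s s′ (trans (size-canonical u₁) (sym (size-canonical v₁)))
  ... | refl = ⊗-cong (canonical-unique u₁ v₁) (canonical-unique u₂ v₂) ⟩∘⟨refl
  canonical-unique (u₁ ⊙⟨ s ⟩ u₂) (v₁ ⊙⟨ s′ ⟩ v₂)
    with split⊙-unique s s′ (trans (size-canonical u₁) (sym (size-canonical v₁)))
  ... | refl = ⊙-cong (canonical-unique u₁ v₁) (canonical-unique u₂ v₂) ⟩∘⟨refl

  thin : (k : Kind) → FreeThin k S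
  thin k f g with canonical f | canonical g
  ... | u , f≈u | v , g≈v = begin
    f       ≈⟨ f≈u ⟩
    ⟦ u ⟧   ≈⟨ canonical-unique u v ⟩
    ⟦ v ⟧   ≈⟨ g≈v ⟨
    g       ∎

theorem5p7 : (S : Set) → FreeThin strong S × FreeThin lax S
theorem5p7 S = thin strong , thin lax
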